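{- Let $p$ be a partial order on a finite set $I$ with $n=|I|$, and let $\ell_0$ be a linear extension of the reverse partial order $\overline p$. Then for every $S\subseteq[n-1]$, $$[m(a,b)_S]\,\Psi^\zeta_p=\#\Big\{\ell \text{ a linear extension of } p:\ \mathrm{Des}\tbinom{\ell_0}{\ell}=S\Big\}.$$
   Context: For a partial order $p$ on $I$, a lower set is $S\subseteq I$ with $s\in S$, $a\le_p s\Rightarrow a\in S$. For an integer composition $\alpha=(\alpha_1,\dots,\alpha_k)$ of $n$, let $f^\zeta_\alpha(p)$ be the number of set compositions $F=(F_1,\dots,F_k)$ of $I$ with $|F_i|=\alpha_i$, every initial union $F_1\cup\dots\cup F_i$ a lower set of $p$, and every block $F_i$ an antichain of $p$ (this is the flag $f$-vector of the character $\zeta$ of the Hopf monoid of partial orders, $\zeta_I(p)=1$ iff $p$ is an antichain). The flag $h$-vector is $h^\zeta_\alpha=\sum_\beta(-1)^{\ell(\alpha)-\ell(\beta)}f^\zeta_\beta$, over compositions $\beta$ obtained from $\alpha$ by merging consecutive parts ($\ell$ = number of parts). Identify $\alpha$ with $S(\alpha)=\{\alpha_1,\alpha_1+\alpha_2,\dots,\alpha_1+\dots+\alpha_{k-1}\}\subseteq[n-1]$. $m(a,b)_S=u_1\cdots u_{n-1}$ with $u_i=b$ if $i\in S$ and $a$ otherwise; $\Psi^\zeta_p=\sum_S h^\zeta_S(p)\,m(a,b)_S$. For linear orders $\ell_0=(x_1,\dots,x_n)$, $\ell=(y_1,\dots,y_n)$ of $I$, let $\sigma\in S_n$ with $y_j=x_{\sigma(j)}$;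 $\mathrm{Des}\binom{\ell_0}{\ell}=\{i\in[n-1]:\sigma(i)>\sigma(i+1)\}$. $\overline p$ is $p$ with all relations reversed. -}

module Defs where

open import Level using (0ℓ)
open import Data.Bool using (Bool; true; false; if_then_else_)
open import Data.Nat as ℕ using (ℕ; zero; suc; _∸_; _<ᵇ_)
import Data.Nat.Properties as ℕP
import Data.Vec.Properties as VecP
open import Data.Nat.ListAction using (sum)
open import Data.Integer as ℤ using (ℤ; +_; -1ℤ)
open import Data.Fin as Fin using (Fin; toℕ)
open import Data.Fin.Properties using (all?) renaming (_≟_ to _≟F_; _≤?_ to _≤?F_)
open import Data.Fin.Subset using (Subset)
open import Data.List as List using (List; []; _∷_; length; filter; concatMap; allFin; upTo; _++_)
open import Data.List.Membership.DecPropositional ℕP._≟_ using (_∈?_)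
open import Data.Vec as Vec using (Vec; lookup; tabulate)
open import Data.Product using (_×_; _,_; proj₁; proj₂)
open import Relation.Binary using (Rel; Decidable)
open import Relation.Binary.PropositionalEquality using (_≡_)
open import Relation.Nullary using (Dec; does)
open import Relation.Nullary.Decidable using (_→-dec_; _×-dec_)
open import Relation.Unary using (Pred)
import Relation.Unary as U

allVec : {A : Set} → (k : ℕ) → List A → List (Vec A k)
allVec zero    xs = Vec.[] ∷ []
allVec (suc k) xs = concatMap (λ x → List.map (x Vec.∷_) (allVec k xs)) xs

count : {A : Set} {P : Pred A 0ℓ} → U.Decidable P → List A → ℕ
count P? xs = length (filter P? xs)

sumℤ : List ℤ → ℤ
sumℤ = List.foldr ℤ._+_ (+ 0)

compositions : ℕ → List (List ℕ)
compositions n =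
  filter (λ α → sum α ℕP.≟ n)
    (concatMap (λ k → List.map Vec.toList (allVec k (List.map suc (upTo n))))
               (upTo (suc n)))

-- compositions obtained from (x ∷ r) by merging consecutive parts
-- (one for each choice of which gaps are merged)
coarsen′ : ℕ → List ℕ → List (List ℕ)
coarsen′ x []      = (x ∷ []) ∷ []
coarsen′ x (y ∷ r) = List.map (x ∷_) (coarsen′ y r) ++ coarsen′ (x ℕ.+ y) r

coarsenings : List ℕ → List (List ℕ)
coarsenings []      = [] ∷ []
coarsenings (x ∷ r) = coarsen′ x r

-- S(α) = {α₁, α₁+α₂, …, α₁+…+α_{k-1}} as a list of naturals
partialSums : ℕ → List ℕ → List ℕ
partialSums acc []          = []
partialSums acc (x ∷ [])    = []
partialSums acc (x ∷ y ∷ r) = (acc ℕ.+ x) ∷ partialSums (acc ℕ.+ x) (y ∷ r)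

-- subsets of [n-1] = {1,…,n-1} are encoded as Subset (n ∸ 1);
-- index i : Fin (n ∸ 1) stands for the element toℕ i + 1.
S[_] : {n : ℕ} → List ℕ → Subset (n ∸ 1)
S[ α ] = tabulate (λ i → does (suc (toℕ i) ∈? partialSums 0 α))

data AB : Set where
  𝐚 𝐛 : AB

_≟AB_ : (x y : AB) → Dec (x ≡ y)
𝐚 ≟AB 𝐚 = Relation.Nullary.yes _≡_.refl
𝐚 ≟AB 𝐛 = Relation.Nullary.no (λ ())
𝐛 ≟AB 𝐚 = Relation.Nullary.no (λ ())
𝐛 ≟AB 𝐛 = Relation.Nullary.yes _≡_.refl

m[_] : {k : ℕ} → Subset k → Vec AB k
m[ S ] = Vec.map (λ s → if s then 𝐛 else 𝐚) S

-- an ab-polynomial (homogeneous of degree k): a formal sum of terms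
-- coefficient · word
ABPoly : ℕ → Set
ABPoly k = List (Vec AB k × ℤ)

coeff : {k : ℕ} → Vec AB k → ABPoly k → ℤ
coeff w P = sumℤ (List.map proj₂ (filter (λ t → VecP.≡-dec _≟AB_ (proj₁ t) w) P))

module _ {n : ℕ} (_≤ₚ_ : Rel (Fin n) 0ℓ) (_≤ₚ?_ : Decidable _≤ₚ_) where

  -- A set composition F = (F₁,…,F_k) of I is encoded by its block map
  -- c : I → Fin k  (F_i = c⁻¹(i)).  It has type β, has all initial unions
  -- lower sets of p, and all blocks antichains of p:
  IsGoodSetComposition : (β : List ℕ) → Vec (Fin (length β)) n → Set
  IsGoodSetComposition β c =
      (∀ (i : Fin (length β)) →
         length (filter (λ x → lookup c x ≟F i) (allFin n)) ≡ List.lookup β i)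
    × (∀ (i : Fin (length β)) (s a : Fin n) →
         Fin._≤_ (lookup c s) i → a ≤ₚ s → Fin._≤_ (lookup c a) i)
    × (∀ (i : Fin (length β)) (x y : Fin n) →
         lookup c x ≡ i → lookup c y ≡ i → x ≤ₚ y → x ≡ y)

  isGoodSetComposition? : (β : List ℕ) → U.Decidable (IsGoodSetComposition β)
  isGoodSetComposition? β c =
        all? (λ i → length (filter (λ x → lookup c x ≟F i) (allFin n))
                      ℕP.≟ List.lookup β i)
    ×-dec all? (λ i → all? (λ s → all? (λ a →
              (lookup c s ≤?F i) →-dec (a ≤ₚ? s) →-dec (lookup c a ≤?F i))))
    ×-dec all? (λ i → all? (λ x → all? (λ y →
              (lookup c x ≟F i) →-dec (lookup c y ≟F i) →-dec (x ≤ₚ? y)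
                →-dec (x ≟F y))))

  flagF : List ℕ → ℕ
  flagF β = count (isGoodSetComposition? β) (allVec n (allFin (length β)))

  flagH : List ℕ → ℤ
  flagH α = sumℤ (List.map (λ β → (-1ℤ ℤ.^ (length α ∸ length β)) ℤ.* (+ flagF β))
                           (coarsenings α))

  Ψζ : ABPoly (n ∸ 1)
  Ψζ = List.map (λ α → (m[ S[_] {n} α ] , flagH α)) (compositions n)

-- Linear orders of I = Fin n, written as sequences (y₁,…,y_n)

module _ {n : ℕ} where

  IsLinearOrder : Vec (Fin n) n → Set
  IsLinearOrder ℓ = ∀ (i j : Fin n) → lookup ℓ i ≡ lookup ℓ j → i ≡ j

  IsLinearExtension : Rel (Fin n) 0ℓ → Vec (Fin n) n → Set
  IsLinearExtension r ℓ =
    IsLinearOrder ℓ × (∀ (i j : Fin n) → r (lookup ℓ i) (lookup ℓ j) → Fin._≤_ i j)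

  isLinearExtension? : (r : Rel (Fin n) 0ℓ) → Decidable r → U.Decidable (IsLinearExtension r)
  isLinearExtension? r r? ℓ =
        all? (λ i → all? (λ j → (lookup ℓ i ≟F lookup ℓ j) →-dec (i ≟F j)))
    ×-dec all? (λ i → all? (λ j → r? (lookup ℓ i) (lookup ℓ j) →-dec (i ≤?F j)))

reverseRel : {n : ℕ} → Rel (Fin n) 0ℓ → Rel (Fin n) 0ℓ
reverseRel r x y = r y x

-- position (1-based) of y in a list; used for σ with y_j = x_{σ(j)}
position : {n : ℕ} → Fin n → List (Fin n) → ℕ
position y []       = 0
position y (x ∷ xs) = if does (x ≟F y) then 1 else suc (position y xs)

σseq : {n : ℕ} → (ℓ₀ ℓ : Vec (Fin n) n) → List ℕ
σseq ℓ₀ ℓ = List.map (λ y → position y (Vec.toList ℓ₀)) (Vec.toList ℓ)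

-- descent indicator list: k-th entry (k = 1,…,length-1) is [σ(k) > σ(k+1)]
descBits : List ℕ → List Bool
descBits (x ∷ y ∷ r) = (y <ᵇ x) ∷ descBits (y ∷ r)
descBits _           = []

-- Des(ℓ₀ over ℓ) as a list of n ∸ 1 bits (entry i ↔ i+1 ∈ [n-1])
Des : {n : ℕ} → (ℓ₀ ℓ : Vec (Fin n) n) → List Bool
Des ℓ₀ ℓ = descBits (σseq ℓ₀ ℓ)

Des≡? : {n : ℕ} (ℓ₀ : Vec (Fin n) n) (S : Subset (n ∸ 1)) →
        U.Decidable (λ ℓ → Des ℓ₀ ℓ ≡ Vec.toList S)
Des≡? ℓ₀ S ℓ = Data.List.Properties.≡-dec Data.Bool._≟_ (Des ℓ₀ ℓ) (Vec.toList S)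
  where import Data.List.Properties; import Data.Bool

numLinExtWithDes : {n : ℕ} (_≤ₚ_ : Rel (Fin n) 0ℓ) → Decidable _≤ₚ_ →
                   Vec (Fin n) n → Subset (n ∸ 1) → ℕ
numLinExtWithDes {n} _≤ₚ_ _≤ₚ?_ ℓ₀ S =
  count (λ ℓ → isLinearExtension? _≤ₚ_ _≤ₚ?_ ℓ ×-dec Des≡? ℓ₀ S ℓ)
        (allVec n (allFin n))

module Submission where

-- Listing I by increasing (block, position in ℓ₀) turns a set composition of type β counted by
-- f_β into a linear extension of p whose descents relative to ℓ₀ lie in S(β): inside a block the
-- elements follow ℓ₀, and initial unions being lower sets makes the listing extend p.
-- Conversely, cutting such a linear extension into consecutive segments of lengths β recovers the
-- set composition: a segment contains no descent, so its elements follow ℓ₀, and since ℓ₀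
-- extends the reverse of p they form an antichain. Hence f_β = #{ℓ : Des ⊆ S(β)}, and the
-- alternating sum over the coarsenings of α leaves exactly h_α = #{ℓ : Des = S(α)}. Only one
-- composition α of n has S(α) = S, so this is the coefficient of m(a,b)_S in Ψ.

open import Defs
open import Level using (0ℓ)
open import Data.Bool using (Bool; true; false; not; T; _∧_; _∨_; if_then_else_)
import Data.Bool.Properties as BoolP
open import Data.Empty using (⊥; ⊥-elim)
open import Data.Fin as Fin using (Fin; toℕ; fromℕ<; punchOut)
import Data.Fin.Properties as FinP
open import Data.Fin.Subset using (Subset)
open import Data.Integer as ℤ using (ℤ; +_; -_; -1ℤ)
import Data.Integer.Properties as ℤP
open import Data.List as List using (List; []; _∷_; length; filter; map; _++_; concatMap; replicate; allFin; upTo; take)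
import Data.List.Properties as ListP
open import Data.List.Membership.Propositional using (_∈_; find)
open import Data.List.Membership.Propositional.Properties
  using (∈-allFin; ∈-filter⁺; ∈-filter⁻; ∈-map⁺; ∈-map⁻; ∈-concatMap⁺; ∈-concatMap⁻; ∈-upTo⁺; ∈-∃++; ∈-++⁻; ∈-++⁺ˡ; ∈-++⁺ʳ)
open import Data.List.Relation.Unary.All as All using (All; []; _∷_)
import Data.List.Relation.Unary.All.Properties as AllP
open import Data.List.Relation.Unary.Any as Any using (here; there)
open import Data.List.Relation.Unary.AllPairs using ([]; _∷_)
open import Data.List.Relation.Unary.Unique.Propositional using (Unique)
import Data.List.Relation.Unary.Unique.Propositional.Properties as UniqueP
open import Data.Nat using (ℕ; zero; suc; _+_; _∸_; _≤_; _<_; z≤n; s≤s; s≤s⁻¹; _<ᵇ_; _<?_; _≤?_)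
open import Data.Nat.Properties
open import Data.List.Membership.DecPropositional _≟_ using (_∈?_)
open import Data.Nat.ListAction using (sum)
open import Data.Nat.ListAction.Properties using (sum-++)
open import Data.Maybe using (Maybe; just; nothing)
import Data.Maybe.Properties as MaybeP
open import Data.Product using (_×_; _,_; proj₁; proj₂; ∃; Σ)
open import Data.Product.Relation.Binary.Lex.Strict using (×-Lex; ×-decidable; ×-transitive; ×-irreflexive; ×-compare)
open import Data.Sum using (_⊎_; inj₁; inj₂)
open import Data.Vec as Vec using (Vec; lookup; toList; tabulate)
import Data.Vec.Properties as VecP
open import Data.Vec.Relation.Binary.Pointwise.Extensional using (ext; Pointwise-≡⇒≡)
open import Function using (_∘_; id; case_of_; Equivalence)
open import Relation.Binary using (Rel; Decidable; IsDecPartialOrder; tri<; tri≈; tri>)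
open import Relation.Binary.PropositionalEquality
open import Relation.Nullary using (yes; no; ¬_; does)
open import Relation.Nullary.Decidable using (_×-dec_; ¬?; T?; dec-true; dec-false)
open import Relation.Unary using (Pred; _≐_; _⊆_)
import Relation.Unary as U

private
  variable
    A B : Set

-- Counting

module _ {P Q : Pred A 0ℓ} (P? : U.Decidable P) (Q? : U.Decidable Q) where

  count-cong : P ≐ Q → ∀ xs → count P? xs ≡ count Q? xs
  count-cong P≐Q xs = cong length (ListP.filter-≐ P? Q? P≐Q xs)

  count-mono : P ⊆ Q → ∀ xs → count P? xs ≤ count Q? xs
  count-mono P⊆Q [] = z≤n
  count-mono P⊆Q (x ∷ xs) with P? x | Q? x
  ... | yes _  | yes _  = s≤s (count-mono P⊆Q xs)
  ... | no _   | yes _  = m≤n⇒m≤1+n (count-mono P⊆Q xs)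
  ... | no _   | no _   = count-mono P⊆Q xs
  ... | yes px | no ¬qx = ⊥-elim (¬qx (P⊆Q px))

  count-mono-< : P ⊆ Q → ∀ {z xs} → z ∈ xs → Q z → ¬ P z → count P? xs < count Q? xs
  count-mono-< P⊆Q {z} {x ∷ xs} (here refl) qz ¬pz with P? z | Q? z
  ... | yes pz | _      = ⊥-elim (¬pz pz)
  ... | no _   | no ¬qz = ⊥-elim (¬qz qz)
  ... | no _   | yes _  = s≤s (count-mono P⊆Q xs)
  count-mono-< P⊆Q {z} {x ∷ xs} (there z∈xs) qz ¬pz with P? x | Q? x
  ... | yes _  | yes _  = s≤s (count-mono-< P⊆Q z∈xs qz ¬pz)
  ... | no _   | yes _  = m≤n⇒m≤1+n (count-mono-< P⊆Q z∈xs qz ¬pz)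
  ... | no _   | no _   = count-mono-< P⊆Q z∈xs qz ¬pz
  ... | yes px | no ¬qx = ⊥-elim (¬qx (P⊆Q px))

  count-split : ∀ xs → count P? xs ≡ count (λ x → P? x ×-dec Q? x) xs
                                   + count (λ x → P? x ×-dec ¬? (Q? x)) xs
  count-split [] = refl
  count-split (x ∷ xs) with P? x | Q? x
  ... | yes _ | yes _ = cong suc (count-split xs)
  ... | yes _ | no _  = trans (cong suc (count-split xs)) (sym (+-suc _ _))
  ... | no _  | _     = count-split xs

count-map : {P : Pred B 0ℓ} (P? : U.Decidable P) (f : A → B) (xs : List A) →
            count P? (map f xs) ≡ count (P? ∘ f) xs
count-map P? f [] = refl
count-map P? f (x ∷ xs) with P? (f x)
... | yes _ = cong suc (count-map P? f xs)
... | no _  = count-map P? f xs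

Unique⇒length≤ : {xs : List A} → Unique xs → (ys : List A) →
                 (∀ {x} → x ∈ xs → x ∈ ys) → length xs ≤ length ys
Unique⇒length≤ {xs = []} _ ys _ = z≤n
Unique⇒length≤ {xs = x ∷ xs} (x∉xs ∷ xs!) ys xs⊆ys with ∈-∃++ (xs⊆ys (here refl))
... | us , vs , refl = begin
    suc (length xs)             ≤⟨ s≤s (Unique⇒length≤ xs! (us ++ vs) xs⊆us++vs) ⟩
    suc (length (us ++ vs))     ≡⟨ cong suc (ListP.length-++ us) ⟩
    suc (length us + length vs) ≡⟨ sym (+-suc (length us) (length vs)) ⟩
    length us + suc (length vs) ≡⟨ sym (ListP.length-++ us) ⟩
    length (us ++ x ∷ vs)       ∎
  where
  open ≤-Reasoning
  xs⊆us++vs : ∀ {z} → z ∈ xs → z ∈ us ++ vs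
  xs⊆us++vs z∈xs with ∈-++⁻ us (xs⊆ys (there z∈xs))
  ... | inj₁ z∈us         = ∈-++⁺ˡ z∈us
  ... | inj₂ (here refl)  = ⊥-elim (All.lookup x∉xs z∈xs refl)
  ... | inj₂ (there z∈vs) = ∈-++⁺ʳ us z∈vs

Unique-map⁺ : {xs : List A} (f : A → B) →
              (∀ {x y} → x ∈ xs → y ∈ xs → f x ≡ f y → x ≡ y) → Unique xs → Unique (map f xs)
Unique-map⁺ f _ [] = []
Unique-map⁺ {xs = x ∷ xs} f f-inj (x∉xs ∷ xs!) =
  All.tabulate fx∉ ∷ Unique-map⁺ f (λ p q → f-inj (there p) (there q)) xs!
  where
  fx∉ : ∀ {z} → z ∈ map f xs → f x ≢ z
  fx∉ z∈ fx≡z with ∈-map⁻ f z∈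
  ... | w , w∈xs , refl = All.lookup x∉xs w∈xs (f-inj (here refl) (there w∈xs) fx≡z)

count-≤-byInjection :
  {P : Pred A 0ℓ} {Q : Pred B 0ℓ} (P? : U.Decidable P) (Q? : U.Decidable Q) {xs : List A} {ys : List B} →
  Unique xs → (f : ∀ {x} → P x → B) →
  (∀ {x} (p : P x) → f p ∈ ys × Q (f p)) →
  (∀ {x y} (p : P x) (q : P y) → f p ≡ f q → x ≡ y) →
  count P? xs ≤ count Q? ys
count-≤-byInjection {A = A} {B} {P} P? Q? {xs} {ys} xs! f f-maps f-inj = begin
  length (filter P? xs)               ≡⟨ sym (ListP.length-map image (filter P? xs)) ⟩
  length (map image (filter P? xs))   ≤⟨ Unique⇒length≤ image! (map just (filter Q? ys)) image⊆ ⟩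
  length (map just (filter Q? ys))    ≡⟨ ListP.length-map just (filter Q? ys) ⟩
  length (filter Q? ys)               ∎
  where
  open ≤-Reasoning
  image : A → Maybe B
  image x with P? x
  ... | yes p = just (f p)
  ... | no _  = nothing
  P-of : ∀ {x} → x ∈ filter P? xs → P x
  P-of x∈ = proj₂ (∈-filter⁻ P? {xs = xs} x∈)
  image-inj : ∀ {x y} → x ∈ filter P? xs → y ∈ filter P? xs → image x ≡ image y → x ≡ y
  image-inj {x} {y} x∈ y∈ eq with P? x | P? y
  ... | yes p | yes q = f-inj p q (MaybeP.just-injective eq)
  ... | no ¬p | _     = ⊥-elim (¬p (P-of x∈))
  ... | _     | no ¬q = ⊥-elim (¬q (P-of y∈))
  image! : Unique (map image (filter P? xs))
  image! = Unique-map⁺ image image-inj (UniqueP.filter⁺ P? xs!)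
  image⊆ : ∀ {z} → z ∈ map image (filter P? xs) → z ∈ map just (filter Q? ys)
  image⊆ z∈ with ∈-map⁻ image z∈
  ... | w , w∈ , refl with P? w
  ...   | yes p = let (fp∈ys , Qfp) = f-maps p in ∈-map⁺ just (∈-filter⁺ Q? fp∈ys Qfp)
  ...   | no ¬p = ⊥-elim (¬p (P-of w∈))

module _ {xs : List A} where

  ∈-allVec⁺ : ∀ {k} (v : Vec A k) → All (_∈ xs) (toList v) → v ∈ allVec k xs
  ∈-allVec⁺ Vec.[] [] = here refl
  ∈-allVec⁺ {suc k} (x Vec.∷ v) (x∈xs ∷ v⊆xs) =
    ∈-concatMap⁺ (λ y → map (y Vec.∷_) (allVec k xs))
      (Any.map (λ { refl → ∈-map⁺ (x Vec.∷_) (∈-allVec⁺ v v⊆xs) }) x∈xs)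

  ∈-allVec⁻ : ∀ {k} (v : Vec A k) → v ∈ allVec k xs → All (_∈ xs) (toList v)
  ∈-allVec⁻ Vec.[] _ = []
  ∈-allVec⁻ {suc k} v v∈ with find (∈-concatMap⁻ (λ y → map (y Vec.∷_) (allVec k xs)) {xs = xs} v∈)
  ... | x , x∈xs , v∈x∷ with ∈-map⁻ (x Vec.∷_) v∈x∷
  ... | w , w∈ , refl = x∈xs ∷ ∈-allVec⁻ w w∈

  Unique-allVec : ∀ {k} → Unique xs → Unique (allVec k xs)
  Unique-allVec {zero} _ = [] ∷ []
  Unique-allVec {suc k} xs! = go xs!
    where
    vs! : Unique (allVec k xs)
    vs! = Unique-allVec xs!
    go : {ys : List A} → Unique ys → Unique (concatMap (λ y → map (y Vec.∷_) (allVec k xs)) ys)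
    go [] = []
    go {y ∷ ys} (y∉ys ∷ ys!) =
      UniqueP.++⁺ (UniqueP.map⁺ VecP.∷-injectiveʳ vs!) (go ys!) disjoint
      where
      disjoint : ∀ {v} → v ∈ map (y Vec.∷_) (allVec k xs) × v ∈ concatMap (λ y → map (y Vec.∷_) (allVec k xs)) ys → ⊥
      disjoint (v∈₁ , v∈₂) with ∈-map⁻ (y Vec.∷_) v∈₁
      ... | _ , _ , refl with find (∈-concatMap⁻ (λ y → map (y Vec.∷_) (allVec k xs)) {xs = ys} v∈₂)
      ... | y′ , y′∈ys , v∈y′∷ with ∈-map⁻ (y′ Vec.∷_) v∈y′∷
      ... | _ , _ , y∷≡y′∷ = All.lookup y∉ys y′∈ys (VecP.∷-injectiveˡ y∷≡y′∷)

Fin-injective⇒surjective : ∀ {n} (f : Fin n → Fin n) → (∀ x y → f x ≡ f y → x ≡ y) →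
                           ∀ y → ∃ λ x → f x ≡ y
Fin-injective⇒surjective {zero} f _ ()
Fin-injective⇒surjective {suc n} f f-inj y with FinP.any? (λ x → f x FinP.≟ y)
... | yes y∈image = y∈image
... | no y∉image = ⊥-elim (1+n≰n (FinP.injective⇒≤ {f = squeeze} squeeze-inj))
  where
  y≢f : ∀ x → y ≢ f x
  y≢f x y≡fx = y∉image (x , sym y≡fx)
  squeeze : Fin (suc n) → Fin n
  squeeze x = punchOut (y≢f x)
  squeeze-inj : ∀ {x z} → squeeze x ≡ squeeze z → x ≡ z
  squeeze-inj {x} {z} eq = f-inj x z (FinP.punchOut-injective (y≢f x) (y≢f z) eq)

module Inverse {n : ℕ} (f : Fin n → Fin n) (f-inj : ∀ x y → f x ≡ f y → x ≡ y) where

  inv : Fin n → Fin n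
  inv y = proj₁ (Fin-injective⇒surjective f f-inj y)

  f∘inv : ∀ y → f (inv y) ≡ y
  f∘inv y = proj₂ (Fin-injective⇒surjective f f-inj y)

  inv-unique : ∀ {x y} → f x ≡ y → inv y ≡ x
  inv-unique {x} {y} fx≡y = f-inj _ _ (trans (f∘inv y) (sym fx≡y))

  inv∘f : ∀ x → inv (f x) ≡ x
  inv∘f x = inv-unique refl

  inv-injective : ∀ x y → inv x ≡ inv y → x ≡ y
  inv-injective x y eq = trans (sym (f∘inv x)) (trans (cong f eq) (f∘inv y))

countFin : ∀ n {P : Pred (Fin n) 0ℓ} → U.Decidable P → ℕ
countFin n P? = count P? (allFin n)

countFin-< : ∀ {n} t → t ≤ n → countFin n (λ j → toℕ j <? t) ≡ t
countFin-< {n} zero _ = cong length (ListP.filter-none (λ j → toℕ j <? 0) {allFin n} (All.tabulate λ _ ()))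
countFin-< {suc n} (suc t) (s≤s t≤n) = begin
  countFin (suc n) P?                          ≡⟨ cong (λ js → count P? (Fin.zero ∷ js)) (sym (ListP.map-tabulate id Fin.suc)) ⟩
  count P? (Fin.zero ∷ map Fin.suc (allFin n)) ≡⟨ cong suc (count-map P? Fin.suc (allFin n)) ⟩
  suc (countFin n (P? ∘ Fin.suc))              ≡⟨ cong suc (count-cong (P? ∘ Fin.suc) (λ j → toℕ j <? t) (s≤s⁻¹ , s≤s) (allFin n)) ⟩
  suc (countFin n (λ j → toℕ j <? t))          ≡⟨ cong suc (countFin-< t t≤n) ⟩
  suc t                                        ∎
  where
  open ≡-Reasoning
  P? = λ (j : Fin (suc n)) → toℕ j <? suc t

countFin-<-suc : ∀ {n} (key : Fin n → ℕ) m → countFin n (λ j → key j <? suc m)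
                 ≡ countFin n (λ j → key j <? m) + countFin n (λ j → key j ≟ m)
countFin-<-suc {n} key m = trans (count-split (λ j → key j <? suc m) (λ j → key j <? m) (allFin n))
  (cong₂ _+_ (count-cong _ (λ j → key j <? m) (proj₂ , λ k<m → m≤n⇒m≤1+n k<m , k<m) (allFin n))
             (count-cong _ (λ j → key j ≟ m) (exactly-m , λ k≡m → ≤-reflexive (cong suc k≡m) , <-irrefl k≡m) (allFin n)))
  where
  exactly-m : ∀ {j} → key j < suc m × ¬ key j < m → key j ≡ m
  exactly-m (k<1+m , k≮m) = ≤-antisym (s≤s⁻¹ k<1+m) (≮⇒≥ k≮m)

countFin-reindex : ∀ {n} {P : Pred (Fin n) 0ℓ} (P? : U.Decidable P) (f : Fin n → Fin n) →
                   (∀ x y → f x ≡ f y → x ≡ y) → countFin n (P? ∘ f) ≡ countFin n P?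
countFin-reindex {n} {P} P? f f-inj = ≤-antisym
  (count-≤-byInjection (P? ∘ f) P? (UniqueP.allFin⁺ n) (λ {x} _ → f x)
     (λ {x} Pfx → ∈-allFin (f x) , Pfx) (λ _ _ → f-inj _ _))
  (count-≤-byInjection P? (P? ∘ f) (UniqueP.allFin⁺ n) (λ {y} _ → inv y)
     (λ {y} Py → ∈-allFin (inv y) , subst P (sym (f∘inv y)) Py) (λ _ _ → inv-injective _ _))
  where open Inverse f f-inj

-- Compositions and their cut sets

Positive : List ℕ → Set
Positive = All (0 <_)

-- Entry t of cuts α says whether t + 1 ∈ S(α).
cuts : List ℕ → List Bool
cuts []          = []
cuts (x ∷ [])    = replicate (x ∸ 1) false
cuts (x ∷ y ∷ r) = replicate (x ∸ 1) false ++ true ∷ cuts (y ∷ r)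

bitAt : List Bool → ℕ → Bool
bitAt []       _       = false
bitAt (b ∷ bs) zero    = b
bitAt (b ∷ bs) (suc t) = bitAt bs t

natAt : List ℕ → ℕ → ℕ
natAt []       _       = 0
natAt (x ∷ xs) zero    = x
natAt (x ∷ xs) (suc t) = natAt xs t

bitAt≡true⇒< : ∀ bs t → bitAt bs t ≡ true → t < length bs
bitAt≡true⇒< (b ∷ bs) zero    _  = s≤s z≤n
bitAt≡true⇒< (b ∷ bs) (suc t) eq = s≤s (bitAt≡true⇒< bs t eq)

<∸1⇒suc< : ∀ {n t} → t < n ∸ 1 → suc t < n
<∸1⇒suc< {suc n} lt = s≤s lt

bit : Bool → ℕ
bit true  = 1
bit false = 0

length-cuts : ∀ {n} α → Positive α → sum α ≡ n → length (cuts α) ≡ n ∸ 1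
length-cuts [] _ refl = refl
length-cuts (zero ∷ _) (() ∷ _) _
length-cuts (suc x ∷ []) _ refl = trans (ListP.length-replicate x) (sym (+-identityʳ x))
length-cuts (suc x ∷ y ∷ r) (_ ∷ y∷r>0) refl = begin
  length (replicate x false ++ true ∷ cuts (y ∷ r))    ≡⟨ ListP.length-++ (replicate x false) ⟩
  length (replicate x false) + suc (length (cuts (y ∷ r))) ≡⟨ cong₂ (λ a b → a + suc b) (ListP.length-replicate x) (length-cuts (y ∷ r) y∷r>0 refl) ⟩
  x + suc (sum (y ∷ r) ∸ 1)                            ≡⟨ cong (λ s → x + s) (m+[n∸m]≡n {1} {sum (y ∷ r)} (sum-positive y∷r>0)) ⟩
  x + sum (y ∷ r)                                      ∎
  where
  open ≡-Reasoning
  sum-positive : ∀ {y r} → Positive (y ∷ r) → 1 ≤ sum (y ∷ r)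
  sum-positive {zero}  (() ∷ _)
  sum-positive {suc y} _ = s≤s z≤n

cuts-shift : ∀ x r t → bitAt (cuts (suc (suc x) ∷ r)) (suc t) ≡ bitAt (cuts (suc x ∷ r)) t
cuts-shift x [] t      = refl
cuts-shift x (y ∷ r) t = refl

cuts-head : ∀ x r → bitAt (cuts (suc (suc x) ∷ r)) 0 ≡ false
cuts-head x []      = refl
cuts-head x (y ∷ r) = refl

cuts-snoc : ∀ p π x → cuts ((p ∷ π) ++ x ∷ []) ≡ cuts (p ∷ π) ++ true ∷ replicate (x ∸ 1) false
cuts-snoc p [] x = refl
cuts-snoc p (q ∷ π) x =
  trans (cong (λ z → replicate (p ∸ 1) false ++ true ∷ z) (cuts-snoc q π x))
        (sym (ListP.++-assoc (replicate (p ∸ 1) false) (true ∷ cuts (q ∷ π)) _))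

replicate-+ : ∀ m n (a : A) → replicate (m + n) a ≡ replicate m a ++ replicate n a
replicate-+ zero    n a = refl
replicate-+ (suc m) n a = cong (a ∷_) (replicate-+ m n a)

cuts-merge : ∀ x y r → cuts (suc x + suc y ∷ r) ≡ replicate x false ++ false ∷ cuts (suc y ∷ r)
cuts-merge x y []      = replicate-+ x (suc y) false
cuts-merge x y (w ∷ r) =
  trans (cong (_++ true ∷ cuts (w ∷ r)) (replicate-+ x (suc y) false))
        (ListP.++-assoc (replicate x false) (false ∷ replicate y false) _)

-- block β t is the index of the part of β containing position t (counted from 0).
mutual
  block : List ℕ → ℕ → ℕ
  block []      t = 0
  block (x ∷ r) t = block′ x r t

  block′ : ℕ → List ℕ → ℕ → ℕ
  block′ zero    r t       = suc (block r t)
  block′ (suc x) r zero    = 0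
  block′ (suc x) r (suc t) = block′ x r t

prefixSum : List ℕ → ℕ → ℕ
prefixSum β i = sum (take i β)

block′-< : ∀ x r t → t < x → block′ x r t ≡ 0
block′-< (suc x) r zero    _         = refl
block′-< (suc x) r (suc t) (s≤s t<x) = block′-< x r t t<x

block′-+ : ∀ x r u → block′ x r (x + u) ≡ suc (block r u)
block′-+ zero    r u = refl
block′-+ (suc x) r u = block′-+ x r u

block<⇔<prefixSum : ∀ β t i → t < sum β → (block β t < i → t < prefixSum β i) × (t < prefixSum β i → block β t < i)
block<⇔<prefixSum []      t i       ()
block<⇔<prefixSum (x ∷ r) t zero    _ = (λ ()) , (λ ())
block<⇔<prefixSum (x ∷ r) t (suc i) t<sum with t <? x
... | yes t<x = (λ _ → ≤-trans t<x (m≤m+n x _)) , (λ _ → subst (_< suc i) (sym (block′-< x r t t<x)) (s≤s z≤n))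
... | no t≮x = to , from
  where
  u = t ∸ x
  x+u≡t : x + u ≡ t
  x+u≡t = m+[n∸m]≡n (≮⇒≥ t≮x)
  block≡ : block′ x r t ≡ suc (block r u)
  block≡ = trans (cong (block′ x r) (sym x+u≡t)) (block′-+ x r u)
  IH = block<⇔<prefixSum r u i (+-cancelˡ-< x u (sum r) (subst (_< x + sum r) (sym x+u≡t) t<sum))
  to : block′ x r t < suc i → t < x + prefixSum r i
  to lt = subst (_< x + prefixSum r i) x+u≡t (+-monoʳ-< x (proj₁ IH (s≤s⁻¹ (subst (_< suc i) block≡ lt))))
  from : t < x + prefixSum r i → block′ x r t < suc i
  from lt = subst (_< suc i) (sym block≡)
    (s≤s (proj₂ IH (+-cancelˡ-< x u (prefixSum r i) (subst (_< x + prefixSum r i) (sym x+u≡t) lt))))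

mutual
  block-step : ∀ β t → Positive β → suc t < sum β → block β (suc t) ≡ bit (bitAt (cuts β) t) + block β t
  block-step (suc x ∷ r) t (_ ∷ r>0) lt = block′-step x r t r>0 lt

  block′-step : ∀ x r t → Positive r → suc t < suc x + sum r →
                block′ (suc x) r (suc t) ≡ bit (bitAt (cuts (suc x ∷ r)) t) + block′ (suc x) r t
  block′-step zero    []          t       _          (s≤s ())
  block′-step zero    (zero ∷ r)  zero    (() ∷ _)   _
  block′-step zero    (suc y ∷ r) zero    _          _ = refl
  block′-step zero    (y ∷ r)     (suc t) y∷r>0      (s≤s lt) =
    trans (cong suc (block-step (y ∷ r) t y∷r>0 lt)) (sym (+-suc _ _))
  block′-step (suc x) r           zero    _          _ = cong (λ b → bit b + 0) (sym (cuts-head x r))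
  block′-step (suc x) r           (suc t) r>0        (s≤s lt) =
    trans (block′-step x r t r>0 lt) (cong (λ b → bit b + block′ (suc x) r t) (sym (cuts-shift x r t)))

mutual
  block-mono : ∀ β {t t′} → t ≤ t′ → block β t ≤ block β t′
  block-mono []      _  = z≤n
  block-mono (x ∷ r) le = block′-mono x r le

  block′-mono : ∀ x r {t t′} → t ≤ t′ → block′ x r t ≤ block′ x r t′
  block′-mono zero    r le                  = s≤s (block-mono r le)
  block′-mono (suc x) r {zero}  _           = z≤n
  block′-mono (suc x) r {suc t} (s≤s le)    = block′-mono x r le

prefixSum-suc : ∀ β {m} (m<len : m < length β) → prefixSum β (suc m) ≡ prefixSum β m + List.lookup β (fromℕ< m<len)
prefixSum-suc (x ∷ r) {zero}  _            = +-identityʳ x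
prefixSum-suc (x ∷ r) {suc m} (s≤s m<len) = trans (cong (_+_ x) (prefixSum-suc r m<len)) (sym (+-assoc x _ _))

prefixSum-length : ∀ β → prefixSum β (length β) ≡ sum β
prefixSum-length β = cong sum (ListP.take-all (length β) β ≤-refl)

prefixSum-≤ : ∀ β i → prefixSum β i ≤ sum β
prefixSum-≤ β       zero    = z≤n
prefixSum-≤ []      (suc i) = z≤n
prefixSum-≤ (x ∷ r) (suc i) = +-monoʳ-≤ x (prefixSum-≤ r i)

block<length : ∀ β t → t < sum β → block β t < length β
block<length β t lt = proj₂ (block<⇔<prefixSum β t (length β) lt) (subst (t <_) (sym (prefixSum-length β)) lt)

-- Descents relative to ℓ₀

position-lookup : ∀ {n m} (v : Vec (Fin n) m) → (∀ i j → lookup v i ≡ lookup v j → i ≡ j) →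
                  ∀ i → position (lookup v i) (toList v) ≡ suc (toℕ i)
position-lookup (x Vec.∷ v) _ Fin.zero with x FinP.≟ x
... | yes _  = refl
... | no x≢x = ⊥-elim (x≢x refl)
position-lookup (x Vec.∷ v) v-inj (Fin.suc i) with x FinP.≟ lookup v i
... | yes x≡vᵢ = case v-inj Fin.zero (Fin.suc i) x≡vᵢ of λ ()
... | no _ = cong suc (position-lookup v (λ a b eq → FinP.suc-injective (v-inj (Fin.suc a) (Fin.suc b) eq)) i)

descBits-map-suc : ∀ xs → descBits (map suc xs) ≡ descBits xs
descBits-map-suc []          = refl
descBits-map-suc (x ∷ [])    = refl
descBits-map-suc (x ∷ y ∷ r) = cong (_ ∷_) (descBits-map-suc (y ∷ r))

length-descBits : ∀ xs → length (descBits xs) ≡ length xs ∸ 1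
length-descBits []          = refl
length-descBits (x ∷ [])    = refl
length-descBits (x ∷ y ∷ r) = cong suc (length-descBits (y ∷ r))

bitAt-descBits : ∀ xs t → suc t < length xs → bitAt (descBits xs) t ≡ (natAt xs (suc t) <ᵇ natAt xs t)
bitAt-descBits (x ∷ [])    zero    (s≤s ())
bitAt-descBits (x ∷ y ∷ r) zero    _        = refl
bitAt-descBits (x ∷ y ∷ r) (suc t) (s≤s lt) = bitAt-descBits (y ∷ r) t lt

natAt-map-toList : ∀ {n} (g : A → ℕ) (v : Vec A n) (j : Fin n) → natAt (map g (toList v)) (toℕ j) ≡ g (lookup v j)
natAt-map-toList g (x Vec.∷ v) Fin.zero    = refl
natAt-map-toList g (x Vec.∷ v) (Fin.suc j) = natAt-map-toList g v j

module Ranks {n : ℕ} (ℓ₀ : Vec (Fin n) n) (ℓ₀-linear : IsLinearOrder ℓ₀) where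

  open Inverse (lookup ℓ₀) ℓ₀-linear

  -- the position of x in ℓ₀, counted from 0
  rank : Fin n → ℕ
  rank x = toℕ (inv x)

  rank-injective : ∀ x y → rank x ≡ rank y → x ≡ y
  rank-injective x y eq = inv-injective x y (FinP.toℕ-injective eq)

  rank-mono : (R : Rel (Fin n) 0ℓ) → (∀ i j → R (lookup ℓ₀ i) (lookup ℓ₀ j) → i Fin.≤ j) →
              ∀ {x y} → R x y → rank x ≤ rank y
  rank-mono R ℓ₀-extends {x} {y} xRy = ℓ₀-extends (inv x) (inv y) (subst₂ R (sym (f∘inv x)) (sym (f∘inv y)) xRy)

  rankAt : Vec (Fin n) n → ℕ → ℕ
  rankAt ℓ t = natAt (map rank (toList ℓ)) t

  rankAt-lookup : ∀ ℓ j → rankAt ℓ (toℕ j) ≡ rank (lookup ℓ j)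
  rankAt-lookup ℓ j = natAt-map-toList rank ℓ j

  rankAt-fromℕ< : ∀ ℓ {t} (t<n : t < n) → rankAt ℓ t ≡ rank (lookup ℓ (fromℕ< t<n))
  rankAt-fromℕ< ℓ t<n = trans (cong (rankAt ℓ) (sym (FinP.toℕ-fromℕ< t<n))) (rankAt-lookup ℓ (fromℕ< t<n))

  Des≡descBits : ∀ ℓ → Des ℓ₀ ℓ ≡ descBits (map rank (toList ℓ))
  Des≡descBits ℓ = begin
    descBits (map (λ y → position y (toList ℓ₀)) (toList ℓ)) ≡⟨ cong descBits (ListP.map-cong position≡ (toList ℓ)) ⟩
    descBits (map (suc ∘ rank) (toList ℓ))                   ≡⟨ cong descBits (ListP.map-∘ (toList ℓ)) ⟩
    descBits (map suc (map rank (toList ℓ)))                 ≡⟨ descBits-map-suc (map rank (toList ℓ)) ⟩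
    descBits (map rank (toList ℓ))                           ∎
    where
    open ≡-Reasoning
    position≡ : ∀ y → position y (toList ℓ₀) ≡ suc (rank y)
    position≡ y = trans (cong (λ z → position z (toList ℓ₀)) (sym (f∘inv y))) (position-lookup ℓ₀ ℓ₀-linear (inv y))

  length-ranks : ∀ ℓ → length (map rank (toList ℓ)) ≡ n
  length-ranks ℓ = trans (ListP.length-map rank (toList ℓ)) (VecP.length-toList ℓ)

  length-Des : ∀ ℓ → length (Des ℓ₀ ℓ) ≡ n ∸ 1
  length-Des ℓ = trans (cong length (Des≡descBits ℓ))
                       (trans (length-descBits (map rank (toList ℓ))) (cong (_∸ 1) (length-ranks ℓ)))

  bitAt-Des : ∀ ℓ t → suc t < n → bitAt (Des ℓ₀ ℓ) t ≡ (rankAt ℓ (suc t) <ᵇ rankAt ℓ t)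
  bitAt-Des ℓ t lt = trans (cong (λ ds → bitAt ds t) (Des≡descBits ℓ))
                           (bitAt-descBits (map rank (toList ℓ)) t (subst (suc t <_) (sym (length-ranks ℓ)) lt))

-- Descent constraints

data Constraint : Set where
  ascent descent free : Constraint

satisfies : Constraint → Bool → Bool
satisfies ascent  d = not d
satisfies descent d = d
satisfies free    _ = true

fits : List Constraint → List Bool → Bool
fits []       []       = true
fits (c ∷ cs) (d ∷ ds) = satisfies c d ∧ fits cs ds
fits _        _        = false

atMost exactly : Bool → Constraint
atMost true  = free
atMost false = ascent
exactly true  = descent
exactly false = ascent

fits-atMost⇒ : ∀ bs ds → T (fits (map atMost bs) ds) →
               length ds ≡ length bs × (∀ t → bitAt ds t ≡ true → bitAt bs t ≡ true)
fits-atMost⇒ []           []           _ = refl , λ _ ()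
fits-atMost⇒ (false ∷ bs) (false ∷ ds) h = let (len , sub) = fits-atMost⇒ bs ds h in
  cong suc len , λ { zero () ; (suc t) → sub t }
fits-atMost⇒ (true ∷ bs)  (d ∷ ds)     h = let (len , sub) = fits-atMost⇒ bs ds h in
  cong suc len , λ { zero _ → refl ; (suc t) → sub t }

fits-atMost⇐ : ∀ bs ds → length ds ≡ length bs → (∀ t → bitAt ds t ≡ true → bitAt bs t ≡ true) →
               T (fits (map atMost bs) ds)
fits-atMost⇐ []           []           _   _   = _
fits-atMost⇐ (true ∷ bs)  (d ∷ ds)     len sub = fits-atMost⇐ bs ds (suc-injective len) (sub ∘ suc)
fits-atMost⇐ (false ∷ bs) (false ∷ ds) len sub = fits-atMost⇐ bs ds (suc-injective len) (sub ∘ suc)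
fits-atMost⇐ (false ∷ bs) (true ∷ ds)  _   sub with sub 0 refl
... | ()

fits-exactly⇒ : ∀ bs ds → T (fits (map exactly bs) ds) → ds ≡ bs
fits-exactly⇒ []           []           _ = refl
fits-exactly⇒ (true ∷ bs)  (true ∷ ds)  h = cong (true ∷_) (fits-exactly⇒ bs ds h)
fits-exactly⇒ (false ∷ bs) (false ∷ ds) h = cong (false ∷_) (fits-exactly⇒ bs ds h)

fits-exactly-refl : ∀ bs → T (fits (map exactly bs) bs)
fits-exactly-refl []           = _
fits-exactly-refl (true ∷ bs)  = fits-exactly-refl bs
fits-exactly-refl (false ∷ bs) = fits-exactly-refl bs

fits-free : ∀ cs es ds → fits (cs ++ free ∷ es) ds ≡ fits (cs ++ descent ∷ es) ds ∨ fits (cs ++ ascent ∷ es) ds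
fits-free []       es []           = refl
fits-free []       es (true ∷ ds)  = sym (BoolP.∨-identityʳ _)
fits-free []       es (false ∷ ds) = refl
fits-free (c ∷ cs) es []           = refl
fits-free (c ∷ cs) es (d ∷ ds)     =
  trans (cong (satisfies c d ∧_) (fits-free cs es ds)) (BoolP.∧-distribˡ-∨ (satisfies c d) _ _)

fits-descent-ascent-exclusive : ∀ cs es ds → T (fits (cs ++ descent ∷ es) ds) → ¬ T (fits (cs ++ ascent ∷ es) ds)
fits-descent-ascent-exclusive []       es (true ∷ ds)  _  ()
fits-descent-ascent-exclusive []       es (false ∷ ds) ()
fits-descent-ascent-exclusive (c ∷ cs) es (d ∷ ds)     h₁ h₂ =
  fits-descent-ascent-exclusive cs es ds (proj₂ (Equivalence.to BoolP.T-∧ h₁)) (proj₂ (Equivalence.to BoolP.T-∧ h₂))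

fits-free⇒ : ∀ cs es ds → T (fits (cs ++ free ∷ es) ds) → T (fits (cs ++ descent ∷ es) ds) ⊎ T (fits (cs ++ ascent ∷ es) ds)
fits-free⇒ cs es ds h = Equivalence.to BoolP.T-∨ (subst T (fits-free cs es ds) h)

fits-free⇐ : ∀ cs es ds → T (fits (cs ++ descent ∷ es) ds) ⊎ T (fits (cs ++ ascent ∷ es) ds) → T (fits (cs ++ free ∷ es) ds)
fits-free⇐ cs es ds h = subst T (sym (fits-free cs es ds)) (Equivalence.from BoolP.T-∨ h)

module _ {n : ℕ} (_≤ₚ_ : Rel (Fin n) 0ℓ) (_≤ₚ?_ : Decidable _≤ₚ_) (ℓ₀ : Vec (Fin n) n) where

  linExtFitting? : (cs : List Constraint) → U.Decidable (λ ℓ → IsLinearExtension _≤ₚ_ ℓ × T (fits cs (Des ℓ₀ ℓ)))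
  linExtFitting? cs ℓ = isLinearExtension? _≤ₚ_ _≤ₚ?_ ℓ ×-dec T? (fits cs (Des ℓ₀ ℓ))

  linExtCount : List Constraint → ℕ
  linExtCount cs = count (linExtFitting? cs) (allVec n (allFin n))

-- Set compositions of type β and linear extensions with descents in S(β)

module SetCompositionBijection
  {n : ℕ} (_≤ₚ_ : Rel (Fin n) 0ℓ) (_≤ₚ?_ : Decidable _≤ₚ_)
  (ℓ₀ : Vec (Fin n) n) (ℓ₀-ext : IsLinearExtension (reverseRel _≤ₚ_) ℓ₀)
  (β : List ℕ) (β>0 : Positive β) (Σβ≡n : sum β ≡ n) where

  open Ranks ℓ₀ (proj₁ ℓ₀-ext)

  k : ℕ
  k = length β

  rank-antitone : ∀ {x y} → x ≤ₚ y → rank y ≤ rank x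
  rank-antitone = rank-mono (reverseRel _≤ₚ_) (proj₂ ℓ₀-ext)

  <sum : ∀ {t} → t < n → t < sum β
  <sum = subst (_ <_) (sym Σβ≡n)

  blockF : Fin n → Fin k
  blockF j = fromℕ< (block<length β (toℕ j) (<sum (FinP.toℕ<n j)))

  toℕ-blockF : ∀ j → toℕ (blockF j) ≡ block β (toℕ j)
  toℕ-blockF j = FinP.toℕ-fromℕ< _

  block≡ : ∀ {t i} → t < n → prefixSum β i ≤ t → t < prefixSum β (suc i) → block β t ≡ i
  block≡ {t} {i} t<n lower upper = ≤-antisym
    (s≤s⁻¹ (proj₂ (block<⇔<prefixSum β t (suc i) (<sum t<n)) upper))
    (≮⇒≥ (λ b<i → <⇒≱ (proj₁ (block<⇔<prefixSum β t i (<sum t<n)) b<i) lower))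

  block-increase⇒cut : ∀ t → suc t < n → block β t < block β (suc t) → bitAt (cuts β) t ≡ true
  block-increase⇒cut t lt increase with bitAt (cuts β) t | block-step β t β>0 (<sum lt)
  ... | true  | _    = refl
  ... | false | step = ⊥-elim (<-irrefl (sym step) increase)

  cut⇒block-suc : ∀ t → suc t < n → bitAt (cuts β) t ≡ true → block β (suc t) ≡ suc (block β t)
  cut⇒block-suc t lt cut = trans (block-step β t β>0 (<sum lt)) (cong (λ b → bit b + block β t) cut)

  countFin-block< : ∀ m → countFin n (λ j → block β (toℕ j) <? m) ≡ prefixSum β m
  countFin-block< m = trans
    (count-cong _ (λ j → toℕ j <? prefixSum β m)
       ((λ {j} → proj₁ (block<⇔<prefixSum β (toℕ j) m (<sum (FinP.toℕ<n j)))) ,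
        (λ {j} → proj₂ (block<⇔<prefixSum β (toℕ j) m (<sum (FinP.toℕ<n j))))) (allFin n))
    (countFin-< (prefixSum β m) (subst (prefixSum β m ≤_) Σβ≡n (prefixSum-≤ β m)))

  countFin-block≡ : ∀ {m} (m<k : m < k) → countFin n (λ j → block β (toℕ j) ≟ m) ≡ List.lookup β (fromℕ< m<k)
  countFin-block≡ {m} m<k = +-cancelˡ-≡ (prefixSum β m) _ _ (begin
    prefixSum β m + countFin n (λ j → block β (toℕ j) ≟ m)
      ≡⟨ cong (_+ countFin n (λ j → block β (toℕ j) ≟ m)) (sym (countFin-block< m)) ⟩
    countFin n (λ j → block β (toℕ j) <? m) + countFin n (λ j → block β (toℕ j) ≟ m)
      ≡⟨ sym (countFin-<-suc {n} (λ j → block β (toℕ j)) m) ⟩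
    countFin n (λ j → block β (toℕ j) <? suc m)
      ≡⟨ countFin-block< (suc m) ⟩
    prefixSum β (suc m)
      ≡⟨ prefixSum-suc β m<k ⟩
    prefixSum β m + List.lookup β (fromℕ< m<k) ∎)
    where open ≡-Reasoning

  DescentsInCuts : Vec (Fin n) n → Set
  DescentsInCuts ℓ = ∀ t → suc t < n → rankAt ℓ (suc t) < rankAt ℓ t → bitAt (cuts β) t ≡ true

  fits⇒DescentsInCuts : ∀ ℓ → T (fits (map atMost (cuts β)) (Des ℓ₀ ℓ)) → DescentsInCuts ℓ
  fits⇒DescentsInCuts ℓ h t lt isDescent = proj₂ (fits-atMost⇒ (cuts β) (Des ℓ₀ ℓ) h) t
    (trans (bitAt-Des ℓ t lt) (Equivalence.to BoolP.T-≡ (<⇒<ᵇ isDescent)))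

  DescentsInCuts⇒fits : ∀ ℓ → DescentsInCuts ℓ → T (fits (map atMost (cuts β)) (Des ℓ₀ ℓ))
  DescentsInCuts⇒fits ℓ inCuts = fits-atMost⇐ (cuts β) (Des ℓ₀ ℓ)
    (trans (length-Des ℓ) (sym (length-cuts β β>0 Σβ≡n))) descent⇒cut
    where
    descent⇒cut : ∀ t → bitAt (Des ℓ₀ ℓ) t ≡ true → bitAt (cuts β) t ≡ true
    descent⇒cut t d = inCuts t lt (<ᵇ⇒< _ _ (Equivalence.from BoolP.T-≡ (trans (sym (bitAt-Des ℓ t lt)) d)))
      where
      lt : suc t < n
      lt = <∸1⇒suc< (subst (t <_) (length-Des ℓ) (bitAt≡true⇒< (Des ℓ₀ ℓ) t d))

  IsGood : Vec (Fin k) n → Set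
  IsGood = IsGoodSetComposition _≤ₚ_ _≤ₚ?_ β

  module Arrange (c : Vec (Fin k) n) where

    blockOf : Fin n → ℕ
    blockOf x = toℕ (lookup c x)

    key : Fin n → ℕ × ℕ
    key x = blockOf x , rank x

    _≺_ : Rel (Fin n) 0ℓ
    y ≺ x = ×-Lex _≡_ _<_ _<_ (key y) (key x)

    _≺?_ : Decidable _≺_
    y ≺? x = ×-decidable {_≈₁_ = _≡_} {_<₁_ = _<_} {_<₂_ = _<_} _≟_ _<?_ _<?_ (key y) (key x)

    ≺-trans : ∀ {x y z} → x ≺ y → y ≺ z → x ≺ z
    ≺-trans = ×-transitive {_≈₁_ = _≡_} {_<₁_ = _<_} {_<₂_ = _<_} isEquivalence <-resp₂-≡ <-trans <-trans

    ≺-irrefl : ∀ x → ¬ x ≺ x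
    ≺-irrefl x = ×-irreflexive {_≈₁_ = _≡_} {_<₁_ = _<_} {_≈₂_ = _≡_} {_<₂_ = _<_} <-irrefl <-irrefl (refl , refl)

    ≺-connex : ∀ x y → x ≢ y → x ≺ y ⊎ y ≺ x
    ≺-connex x y x≢y with ×-compare {_≈₁_ = _≡_} {_<₁_ = _<_} {_≈₂_ = _≡_} {_<₂_ = _<_} sym <-cmp <-cmp (key x) (key y)
    ... | tri< x≺y _ _         = inj₁ x≺y
    ... | tri≈ _ (_ , ranks) _ = ⊥-elim (x≢y (rank-injective x y ranks))
    ... | tri> _ _ y≺x         = inj₂ y≺x

    ≺⇒block< : ∀ {x y} → x ≺ y → rank y < rank x → blockOf x < blockOf y
    ≺⇒block< (inj₁ lt)              _ = lt
    ≺⇒block< (inj₂ (_ , rank-x<y)) rank-y<x = ⊥-elim (<-asym rank-x<y rank-y<x)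

    slot : Fin n → ℕ
    slot x = countFin n (_≺? x)

    slot-mono-< : ∀ {x y} → x ≺ y → slot x < slot y
    slot-mono-< {x} {y} x≺y = count-mono-< (_≺? x) (_≺? y) (λ z≺x → ≺-trans z≺x x≺y) (∈-allFin x) x≺y (≺-irrefl x)

    slot<n : ∀ x → slot x < n
    slot<n x = subst (slot x <_) (ListP.length-tabulate id)
      (ListP.filter-notAll (_≺? x) (allFin n) (Any.map (λ { refl → ≺-irrefl x }) (∈-allFin x)))

    slot<⇒≺ : ∀ {x y} → slot x < slot y → x ≺ y
    slot<⇒≺ {x} {y} lt with x FinP.≟ y
    ... | yes refl = ⊥-elim (<-irrefl refl lt)
    ... | no x≢y with ≺-connex x y x≢y
    ...   | inj₁ x≺y = x≺y
    ...   | inj₂ y≺x = ⊥-elim (<-asym lt (slot-mono-< y≺x))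

    slot-injective : ∀ x y → slot x ≡ slot y → x ≡ y
    slot-injective x y eq with x FinP.≟ y
    ... | yes x≡y = x≡y
    ... | no x≢y with ≺-connex x y x≢y
    ...   | inj₁ x≺y = ⊥-elim (<-irrefl eq (slot-mono-< x≺y))
    ...   | inj₂ y≺x = ⊥-elim (<-irrefl (sym eq) (slot-mono-< y≺x))

    slotF : Fin n → Fin n
    slotF x = fromℕ< (slot<n x)

    toℕ-slotF : ∀ x → toℕ (slotF x) ≡ slot x
    toℕ-slotF x = FinP.toℕ-fromℕ< (slot<n x)

    slotF-injective : ∀ x y → slotF x ≡ slotF y → x ≡ y
    slotF-injective x y eq = slot-injective x y (trans (sym (toℕ-slotF x)) (trans (cong toℕ eq) (toℕ-slotF y)))

    open Inverse slotF slotF-injective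

    arrange : Vec (Fin n) n
    arrange = tabulate inv

    lookup-arrange : ∀ j → lookup arrange j ≡ inv j
    lookup-arrange j = VecP.lookup∘tabulate inv j

    lookup-arrange-slotF : ∀ x → lookup arrange (slotF x) ≡ x
    lookup-arrange-slotF x = trans (lookup-arrange (slotF x)) (inv∘f x)

    slot-lookup-arrange : ∀ j → slot (lookup arrange j) ≡ toℕ j
    slot-lookup-arrange j = begin
      slot (lookup arrange j)        ≡⟨ sym (toℕ-slotF _) ⟩
      toℕ (slotF (lookup arrange j)) ≡⟨ cong (toℕ ∘ slotF) (lookup-arrange j) ⟩
      toℕ (slotF (inv j))            ≡⟨ cong toℕ (f∘inv j) ⟩
      toℕ j                          ∎
      where open ≡-Reasoning

    arrange-linear : IsLinearOrder arrange
    arrange-linear i j eq = inv-injective i j (trans (sym (lookup-arrange i)) (trans eq (lookup-arrange j)))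

    module _ (good : IsGood c) where

      countFin-blockOf≡ : ∀ {m} (m<k : m < k) → countFin n (λ y → blockOf y ≟ m) ≡ List.lookup β (fromℕ< m<k)
      countFin-blockOf≡ {m} m<k =
        trans (count-cong _ (λ x → lookup c x FinP.≟ fromℕ< m<k) (to , from) (allFin n)) (proj₁ good (fromℕ< m<k))
        where
        to : ∀ {x} → blockOf x ≡ m → lookup c x ≡ fromℕ< m<k
        to eq = FinP.toℕ-injective (trans eq (sym (FinP.toℕ-fromℕ< m<k)))
        from : ∀ {x} → lookup c x ≡ fromℕ< m<k → blockOf x ≡ m
        from eq = trans (cong toℕ eq) (FinP.toℕ-fromℕ< m<k)

      countFin-blockOf< : ∀ m → m ≤ k → countFin n (λ y → blockOf y <? m) ≡ prefixSum β m
      countFin-blockOf< zero    _   = cong length (ListP.filter-none (λ y → blockOf y <? 0) {allFin n} (All.tabulate λ _ ()))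
      countFin-blockOf< (suc m) m<k = begin
        countFin n (λ y → blockOf y <? suc m)                                   ≡⟨ countFin-<-suc blockOf m ⟩
        countFin n (λ y → blockOf y <? m) + countFin n (λ y → blockOf y ≟ m)    ≡⟨ cong₂ _+_ (countFin-blockOf< m (<⇒≤ m<k)) (countFin-blockOf≡ m<k) ⟩
        prefixSum β m + List.lookup β (fromℕ< m<k)                              ≡⟨ sym (prefixSum-suc β m<k) ⟩
        prefixSum β (suc m)                                                     ∎
        where open ≡-Reasoning

      -- slot x counts the elements of the earlier blocks, plus fewer than the size of x's own block.
      block-slot : ∀ x → block β (slot x) ≡ blockOf x
      block-slot x = block≡ (slot<n x) (subst (_≤ slot x) earlier≡ (≤-trans (m≤m+n earlier same) (≤-reflexive (sym split))))
        (begin-strict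
          slot x                                               ≡⟨ split ⟩
          earlier + same                                       <⟨ +-monoʳ-< earlier same< ⟩
          earlier + List.lookup β (fromℕ< x-block<k)            ≡⟨ cong (_+ List.lookup β (fromℕ< x-block<k)) earlier≡ ⟩
          prefixSum β (blockOf x) + List.lookup β (fromℕ< x-block<k) ≡⟨ sym (prefixSum-suc β x-block<k) ⟩
          prefixSum β (suc (blockOf x))                        ∎)
        where
        open ≤-Reasoning
        x-block<k : blockOf x < k
        x-block<k = FinP.toℕ<n (lookup c x)
        earlier = countFin n (λ y → y ≺? x ×-dec (blockOf y <? blockOf x))
        same    = countFin n (λ y → y ≺? x ×-dec ¬? (blockOf y <? blockOf x))
        split : slot x ≡ earlier + same
        split = count-split (_≺? x) (λ y → blockOf y <? blockOf x) (allFin n)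
        earlier≡ : earlier ≡ prefixSum β (blockOf x)
        earlier≡ = trans (count-cong _ (λ y → blockOf y <? blockOf x) (proj₂ , λ lt → inj₁ lt , lt) (allFin n))
                         (countFin-blockOf< (blockOf x) (<⇒≤ x-block<k))
        same-block : ∀ {y} → y ≺ x × ¬ blockOf y < blockOf x → blockOf y ≡ blockOf x
        same-block (inj₁ lt , ≮) = ⊥-elim (≮ lt)
        same-block (inj₂ (eq , _) , _) = eq
        same< : same < List.lookup β (fromℕ< x-block<k)
        same< = subst (same <_) (countFin-blockOf≡ x-block<k)
          (count-mono-< _ (λ y → blockOf y ≟ blockOf x) same-block (∈-allFin x) refl (≺-irrefl x ∘ proj₁))

      slot-mono : ∀ {x y} → x ≤ₚ y → slot x ≤ slot y
      slot-mono {x} {y} x≤y with x FinP.≟ y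
      ... | yes refl = ≤-refl
      ... | no x≢y   = <⇒≤ (slot-mono-< (inj₁ (≤∧≢⇒< lower (x≢y ∘ antichain))))
        where
        lower : blockOf x ≤ blockOf y
        lower = proj₁ (proj₂ good) (lookup c y) y x ≤-refl x≤y
        antichain : blockOf x ≡ blockOf y → x ≡ y
        antichain eq = proj₂ (proj₂ good) (lookup c x) x y refl (sym (FinP.toℕ-injective eq)) x≤y

      arrange-isLinearExtension : IsLinearExtension _≤ₚ_ arrange
      arrange-isLinearExtension = arrange-linear , λ i j le →
        subst₂ _≤_ (slot-lookup-arrange i) (slot-lookup-arrange j) (slot-mono le)

      arrange-DescentsInCuts : DescentsInCuts arrange
      arrange-DescentsInCuts t lt isDescent = block-increase⇒cut t lt (subst₂ _<_ (block-at t<n) (block-at lt) x-block<y-block)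
        where
        t<n = <-trans (n<1+n t) lt
        element : ∀ {u} → u < n → Fin n
        element u<n = lookup arrange (fromℕ< u<n)
        slot-element : ∀ {u} (u<n : u < n) → slot (element u<n) ≡ u
        slot-element u<n = trans (slot-lookup-arrange (fromℕ< u<n)) (FinP.toℕ-fromℕ< u<n)
        block-at : ∀ {u} (u<n : u < n) → blockOf (element u<n) ≡ block β u
        block-at u<n = trans (sym (block-slot (element u<n))) (cong (block β) (slot-element u<n))
        x = element t<n
        y = element lt
        rank-y<rank-x : rank y < rank x
        rank-y<rank-x = subst₂ _<_ (rankAt-fromℕ< arrange lt) (rankAt-fromℕ< arrange t<n) isDescent
        x-block<y-block : blockOf x < blockOf y
        x-block<y-block = ≺⇒block< (slot<⇒≺ (subst₂ _<_ (sym (slot-element t<n)) (sym (slot-element lt)) (n<1+n t)))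
                                   rank-y<rank-x

  arrange-injective : ∀ {c c′} → IsGood c → IsGood c′ → Arrange.arrange c ≡ Arrange.arrange c′ → c ≡ c′
  arrange-injective {c} {c′} good good′ same = Pointwise-≡⇒≡ (ext λ x → FinP.toℕ-injective (begin
    C.blockOf x                ≡⟨ sym (C.block-slot good x) ⟩
    block β (C.slot x)         ≡⟨ cong (block β) (slot≡ x) ⟩
    block β (C′.slot x)        ≡⟨ C′.block-slot good′ x ⟩
    C′.blockOf x               ∎))
    where
    open ≡-Reasoning
    module C  = Arrange c
    module C′ = Arrange c′
    slotF≡ : ∀ x → C.slotF x ≡ C′.slotF x
    slotF≡ x = C′.arrange-linear _ _ (begin
      lookup C′.arrange (C.slotF x)   ≡⟨ cong (λ v → lookup v (C.slotF x)) (sym same) ⟩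
      lookup C.arrange (C.slotF x)    ≡⟨ C.lookup-arrange-slotF x ⟩
      x                               ≡⟨ sym (C′.lookup-arrange-slotF x) ⟩
      lookup C′.arrange (C′.slotF x)  ∎)
    slot≡ : ∀ x → C.slot x ≡ C′.slot x
    slot≡ x = trans (sym (C.toℕ-slotF x)) (trans (cong toℕ (slotF≡ x)) (C′.toℕ-slotF x))

  module BlocksOf (ℓ : Vec (Fin n) n) (ℓ-ext : IsLinearExtension _≤ₚ_ ℓ) (inCuts : DescentsInCuts ℓ) where

    open Inverse (lookup ℓ) (proj₁ ℓ-ext) renaming (inv to pos; f∘inv to lookup-pos; inv∘f to pos-lookup)

    blocksOf : Vec (Fin k) n
    blocksOf = tabulate (blockF ∘ pos)

    open Arrange blocksOf using (blockOf; _≺_; _≺?_; slot; arrange; slotF; toℕ-slotF; lookup-arrange-slotF)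

    blockOf-pos : ∀ x → blockOf x ≡ block β (toℕ (pos x))
    blockOf-pos x = trans (cong toℕ (VecP.lookup∘tabulate (blockF ∘ pos) x)) (toℕ-blockF (pos x))

    rankAt-pos : ∀ y → rankAt ℓ (toℕ (pos y)) ≡ rank y
    rankAt-pos y = trans (rankAt-lookup ℓ (pos y)) (cong rank (lookup-pos y))

    pos-mono : ∀ {x y} → x ≤ₚ y → toℕ (pos x) ≤ toℕ (pos y)
    pos-mono {x} {y} x≤y = proj₂ ℓ-ext (pos x) (pos y) (subst₂ _≤ₚ_ (sym (lookup-pos x)) (sym (lookup-pos y)) x≤y)

    -- There is no descent inside a block, so ranks increase along it.
    rankAt-monoWithinBlock : ∀ {a b} → a ≤ b → b < n → block β a ≡ block β b → rankAt ℓ a ≤ rankAt ℓ b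
    rankAt-monoWithinBlock {a} {zero}  z≤n _ _ = ≤-refl
    rankAt-monoWithinBlock {a} {suc b} a≤1+b 1+b<n same with a ≤? b
    ... | no a≰b  = ≤-reflexive (cong (rankAt ℓ) (≤-antisym a≤1+b (≰⇒> a≰b)))
    ... | yes a≤b = ≤-trans (rankAt-monoWithinBlock a≤b (<-trans (n<1+n b) 1+b<n) a~b) (≮⇒≥ no-descent)
      where
      a~b : block β a ≡ block β b
      a~b = ≤-antisym (block-mono β a≤b) (subst (block β b ≤_) (sym same) (block-mono β (n≤1+n b)))
      no-descent : ¬ rankAt ℓ (suc b) < rankAt ℓ b
      no-descent isDescent = <-irrefl (trans (sym a~b) same)
        (subst (block β b <_) (sym (cut⇒block-suc b 1+b<n (inCuts b 1+b<n isDescent))) (n<1+n (block β b)))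

    rank-monoWithinBlock : ∀ x y → toℕ (pos x) ≤ toℕ (pos y) → blockOf x ≡ blockOf y → rank x ≤ rank y
    rank-monoWithinBlock x y le same = subst₂ _≤_ (rankAt-pos x) (rankAt-pos y)
      (rankAt-monoWithinBlock le (FinP.toℕ<n (pos y)) (trans (sym (blockOf-pos x)) (trans same (blockOf-pos y))))

    blocksOf-good : IsGood blocksOf
    blocksOf-good = sizes , lower , antichain
      where
      sizes : ∀ i → length (filter (λ x → lookup blocksOf x FinP.≟ i) (allFin n)) ≡ List.lookup β i
      sizes i = begin
        countFin n (λ x → lookup blocksOf x FinP.≟ i)
          ≡⟨ count-cong _ (λ x → block β (toℕ (pos x)) ≟ toℕ i)
               ((λ eq → trans (sym (blockOf-pos _)) (cong toℕ eq)) , (λ eq → FinP.toℕ-injective (trans (blockOf-pos _) eq))) (allFin n) ⟩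
        countFin n (λ x → block β (toℕ (pos x)) ≟ toℕ i)
          ≡⟨ countFin-reindex (λ j → block β (toℕ j) ≟ toℕ i) pos inv-injective ⟩
        countFin n (λ j → block β (toℕ j) ≟ toℕ i)
          ≡⟨ countFin-block≡ (FinP.toℕ<n i) ⟩
        List.lookup β (fromℕ< (FinP.toℕ<n i))
          ≡⟨ cong (List.lookup β) (FinP.fromℕ<-toℕ i (FinP.toℕ<n i)) ⟩
        List.lookup β i ∎
        where open ≡-Reasoning
      lower : ∀ i s a → lookup blocksOf s Fin.≤ i → a ≤ₚ s → lookup blocksOf a Fin.≤ i
      lower i s a s≤i a≤s = ≤-trans (≤-reflexive (blockOf-pos a))
        (≤-trans (block-mono β (pos-mono a≤s)) (≤-trans (≤-reflexive (sym (blockOf-pos s))) s≤i))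
      antichain : ∀ i x y → lookup blocksOf x ≡ i → lookup blocksOf y ≡ i → x ≤ₚ y → x ≡ y
      antichain i x y x∈i y∈i x≤y = rank-injective x y (≤-antisym
        (rank-monoWithinBlock x y (pos-mono x≤y) (cong toℕ (trans x∈i (sym y∈i))))
        (rank-antitone x≤y))

    slot-blocksOf : ∀ x → slot x ≡ toℕ (pos x)
    slot-blocksOf x = begin
      countFin n (_≺? x)                                  ≡⟨ count-cong _ (λ y → toℕ (pos y) <? toℕ (pos x)) (≺⇒pos< , pos<⇒≺) (allFin n) ⟩
      countFin n (λ y → toℕ (pos y) <? toℕ (pos x))       ≡⟨ countFin-reindex (λ j → toℕ j <? toℕ (pos x)) pos inv-injective ⟩
      countFin n (λ j → toℕ j <? toℕ (pos x))             ≡⟨ countFin-< (toℕ (pos x)) (<⇒≤ (FinP.toℕ<n (pos x))) ⟩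
      toℕ (pos x)                                         ∎
      where
      open ≡-Reasoning
      ≺⇒pos< : ∀ {y} → y ≺ x → toℕ (pos y) < toℕ (pos x)
      ≺⇒pos< {y} (inj₁ y-block<x-block) = ≰⇒> λ x≤y → <⇒≱ y-block<x-block
        (subst₂ _≤_ (sym (blockOf-pos x)) (sym (blockOf-pos y)) (block-mono β x≤y))
      ≺⇒pos< {y} (inj₂ (same , rank-y<x)) = ≰⇒> λ x≤y → <⇒≱ rank-y<x (rank-monoWithinBlock x y x≤y (sym same))
      pos<⇒≺ : ∀ {y} → toℕ (pos y) < toℕ (pos x) → y ≺ x
      pos<⇒≺ {y} y<x with <-cmp (blockOf y) (blockOf x)
      ... | tri< lt _ _ = inj₁ lt
      ... | tri> _ _ gt = ⊥-elim (<⇒≱ gt (subst₂ _≤_ (sym (blockOf-pos y)) (sym (blockOf-pos x)) (block-mono β (<⇒≤ y<x))))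
      ... | tri≈ _ same _ = inj₂ (same , ≤∧≢⇒< (rank-monoWithinBlock y x (<⇒≤ y<x) same)
                                              (λ ranks → <-irrefl (cong (toℕ ∘ pos) (rank-injective y x ranks)) y<x))

    arrange-blocksOf : arrange ≡ ℓ
    arrange-blocksOf = Pointwise-≡⇒≡ (ext λ j → begin
      lookup arrange j                          ≡⟨ cong (lookup arrange) (sym (slotF≡ j)) ⟩
      lookup arrange (slotF (lookup ℓ j))       ≡⟨ lookup-arrange-slotF (lookup ℓ j) ⟩
      lookup ℓ j                                ∎)
      where
      open ≡-Reasoning
      slotF≡ : ∀ j → slotF (lookup ℓ j) ≡ j
      slotF≡ j = FinP.toℕ-injective (trans (toℕ-slotF _) (trans (slot-blocksOf (lookup ℓ j)) (cong toℕ (pos-lookup j))))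

  flagF≡linExtCount : flagF _≤ₚ_ _≤ₚ?_ β ≡ linExtCount _≤ₚ_ _≤ₚ?_ ℓ₀ (map atMost (cuts β))
  flagF≡linExtCount = ≤-antisym
    (count-≤-byInjection (isGoodSetComposition? _≤ₚ_ _≤ₚ?_ β) linExt? (Unique-allVec (UniqueP.allFin⁺ k))
       (λ {c} _ → Arrange.arrange c)
       (λ {c} good → ∈-allVec⁺ _ (All.tabulate λ {x} _ → ∈-allFin x) ,
                     Arrange.arrange-isLinearExtension c good ,
                     DescentsInCuts⇒fits _ (Arrange.arrange-DescentsInCuts c good))
       arrange-injective)
    (count-≤-byInjection linExt? (isGoodSetComposition? _≤ₚ_ _≤ₚ?_ β) (Unique-allVec (UniqueP.allFin⁺ n))
       (λ {ℓ} (isExt , fit) → BlocksOf.blocksOf ℓ isExt (fits⇒DescentsInCuts ℓ fit))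
       (λ {ℓ} (isExt , fit) → ∈-allVec⁺ _ (All.tabulate λ {i} _ → ∈-allFin i) ,
                            BlocksOf.blocksOf-good ℓ isExt (fits⇒DescentsInCuts ℓ fit))
       λ {ℓ} {ℓ′} (isExt , fit) (isExt′ , fit′) same → begin
         ℓ                                                                   ≡⟨ sym (BlocksOf.arrange-blocksOf ℓ isExt (fits⇒DescentsInCuts ℓ fit)) ⟩
         Arrange.arrange (BlocksOf.blocksOf ℓ isExt (fits⇒DescentsInCuts ℓ fit))    ≡⟨ cong Arrange.arrange same ⟩
         Arrange.arrange (BlocksOf.blocksOf ℓ′ isExt′ (fits⇒DescentsInCuts ℓ′ fit′)) ≡⟨ BlocksOf.arrange-blocksOf ℓ′ isExt′ (fits⇒DescentsInCuts ℓ′ fit′) ⟩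
         ℓ′                                                                  ∎)
    where
    open ≡-Reasoning
    linExt? = linExtFitting? _≤ₚ_ _≤ₚ?_ ℓ₀ (map atMost (cuts β))

-- Inclusion–exclusion over coarsenings

sumℤ-++ : ∀ xs ys → sumℤ (xs ++ ys) ≡ sumℤ xs ℤ.+ sumℤ ys
sumℤ-++ []       ys = sym (ℤP.+-identityˡ _)
sumℤ-++ (x ∷ xs) ys = trans (cong (ℤ._+_ x) (sumℤ-++ xs ys)) (sym (ℤP.+-assoc x _ _))

sumℤ-map-cong : (f g : A → ℤ) (xs : List A) → All (λ x → f x ≡ g x) xs → sumℤ (map f xs) ≡ sumℤ (map g xs)
sumℤ-map-cong f g []       []         = refl
sumℤ-map-cong f g (x ∷ xs) (eq ∷ eqs) = cong₂ ℤ._+_ eq (sumℤ-map-cong f g xs eqs)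

sumℤ-map-neg : (f : A → ℤ) (xs : List A) → sumℤ (map (λ x → - f x) xs) ≡ - sumℤ (map f xs)
sumℤ-map-neg f []       = refl
sumℤ-map-neg f (x ∷ xs) = trans (cong (ℤ._+_ (- f x)) (sumℤ-map-neg f xs)) (sym (ℤP.neg-distrib-+ (f x) _))

length-coarsen′ : ∀ x r → All (λ β → length β ≤ suc (length r)) (coarsen′ x r)
length-coarsen′ x []      = s≤s z≤n ∷ []
length-coarsen′ x (y ∷ r) = AllP.++⁺ (AllP.map⁺ (All.map s≤s (length-coarsen′ y r)))
                                      (All.map m≤n⇒m≤1+n (length-coarsen′ (x + y) r))

-- The signed sum over the coarsenings of α, with a fixed prefix π of parts in front.
alternatingSum : (List ℕ → ℤ) → List ℕ → List ℕ → ℤ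
alternatingSum g π α = sumℤ (map (λ β → (-1ℤ ℤ.^ (length α ∸ length β)) ℤ.* g (π ++ β)) (coarsenings α))

-- Either the first two parts of α stay separate (the first one moves to the prefix) or they merge.
alternatingSum-cons₂ : ∀ g π x y r →
  alternatingSum g π (x ∷ y ∷ r) ≡ alternatingSum g (π ++ x ∷ []) (y ∷ r) ℤ.- alternatingSum g π (x + y ∷ r)
alternatingSum-cons₂ g π x y r = begin
  sumℤ (map term (map (x ∷_) kept ++ merged))
    ≡⟨ cong sumℤ (ListP.map-++ term (map (x ∷_) kept) merged) ⟩
  sumℤ (map term (map (x ∷_) kept) ++ map term merged)
    ≡⟨ sumℤ-++ (map term (map (x ∷_) kept)) (map term merged) ⟩
  sumℤ (map term (map (x ∷_) kept)) ℤ.+ sumℤ (map term merged)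
    ≡⟨ cong₂ ℤ._+_ keptSum mergedSum ⟩
  alternatingSum g (π ++ x ∷ []) (y ∷ r) ℤ.- alternatingSum g π (x + y ∷ r) ∎
  where
  open ≡-Reasoning
  kept   = coarsen′ y r
  merged = coarsen′ (x + y) r
  term : List ℕ → ℤ
  term β = (-1ℤ ℤ.^ (suc (suc (length r)) ∸ length β)) ℤ.* g (π ++ β)
  term′ : List ℕ → ℤ
  term′ β = (-1ℤ ℤ.^ (suc (length r) ∸ length β)) ℤ.* g (π ++ β)
  keptSum : sumℤ (map term (map (x ∷_) kept)) ≡ alternatingSum g (π ++ x ∷ []) (y ∷ r)
  keptSum = trans (cong sumℤ (sym (ListP.map-∘ kept)))
    (sumℤ-map-cong _ _ kept (All.tabulate λ {β} _ →
      cong (λ γ → (-1ℤ ℤ.^ (suc (length r) ∸ length β)) ℤ.* g γ) (sym (ListP.++-assoc π (x ∷ []) β))))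
  sign-flip : ∀ {β} → length β ≤ suc (length r) → term β ≡ - term′ β
  sign-flip {β} le = trans (cong (λ e → (-1ℤ ℤ.^ e) ℤ.* g (π ++ β)) (+-∸-assoc 1 le))
    (trans (ℤP.*-assoc -1ℤ (-1ℤ ℤ.^ (suc (length r) ∸ length β)) (g (π ++ β))) (ℤP.-1*i≡-i _))
  mergedSum : sumℤ (map term merged) ≡ - alternatingSum g π (x + y ∷ r)
  mergedSum = trans (sumℤ-map-cong term (λ β → - term′ β) merged (All.map (λ {β} → sign-flip {β}) (length-coarsen′ (x + y) r)))
                    (sumℤ-map-neg term′ merged)

-- Below α the descents must be exactly the cuts of α; below the prefix π they need only lie
-- among the cuts of π, and the junction between π and α is unconstrained.
keptConstraints : List ℕ → List Constraint
keptConstraints []      = []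
keptConstraints (p ∷ π) = map atMost (cuts (p ∷ π)) ++ free ∷ []

mixedConstraints : List ℕ → List ℕ → List Constraint
mixedConstraints π α = keptConstraints π ++ map exactly (cuts α)

atMost-cuts-snoc : ∀ π x → map atMost (cuts (π ++ suc x ∷ [])) ≡ keptConstraints π ++ replicate x ascent
atMost-cuts-snoc []      x = ListP.map-replicate atMost x false
atMost-cuts-snoc (p ∷ π) x = begin
  map atMost (cuts ((p ∷ π) ++ suc x ∷ []))
    ≡⟨ cong (map atMost) (cuts-snoc p π (suc x)) ⟩
  map atMost (cuts (p ∷ π) ++ true ∷ replicate x false)
    ≡⟨ ListP.map-++ atMost (cuts (p ∷ π)) _ ⟩
  map atMost (cuts (p ∷ π)) ++ free ∷ map atMost (replicate x false)
    ≡⟨ cong (λ cs → map atMost (cuts (p ∷ π)) ++ free ∷ cs) (ListP.map-replicate atMost x false) ⟩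
  map atMost (cuts (p ∷ π)) ++ free ∷ replicate x ascent
    ≡⟨ sym (ListP.++-assoc (map atMost (cuts (p ∷ π))) (free ∷ []) _) ⟩
  keptConstraints (p ∷ π) ++ replicate x ascent ∎
  where open ≡-Reasoning

keptConstraints-snoc : ∀ π x → keptConstraints (π ++ suc x ∷ []) ≡ (keptConstraints π ++ replicate x ascent) ++ free ∷ []
keptConstraints-snoc []      x = cong (_++ free ∷ []) (ListP.map-replicate atMost x false)
keptConstraints-snoc (p ∷ π) x = cong (_++ free ∷ []) (atMost-cuts-snoc (p ∷ π) x)

exactly-shape : ∀ cs x b bs →
  cs ++ map exactly (replicate x false ++ b ∷ bs) ≡ (cs ++ replicate x ascent) ++ exactly b ∷ map exactly bs
exactly-shape cs x b bs = begin
  cs ++ map exactly (replicate x false ++ b ∷ bs)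
    ≡⟨ cong (cs ++_) (ListP.map-++ exactly (replicate x false) _) ⟩
  cs ++ (map exactly (replicate x false) ++ exactly b ∷ map exactly bs)
    ≡⟨ cong (λ as → cs ++ (as ++ exactly b ∷ map exactly bs)) (ListP.map-replicate exactly x false) ⟩
  cs ++ (replicate x ascent ++ exactly b ∷ map exactly bs)
    ≡⟨ sym (ListP.++-assoc cs (replicate x ascent) _) ⟩
  (cs ++ replicate x ascent) ++ exactly b ∷ map exactly bs ∎
  where open ≡-Reasoning

mixedConstraints-kept : ∀ π x y r → mixedConstraints (π ++ suc x ∷ []) (suc y ∷ r)
  ≡ (keptConstraints π ++ replicate x ascent) ++ free ∷ map exactly (cuts (suc y ∷ r))
mixedConstraints-kept π x y r =
  trans (cong (_++ map exactly (cuts (suc y ∷ r))) (keptConstraints-snoc π x))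
        (ListP.++-assoc (keptConstraints π ++ replicate x ascent) (free ∷ []) _)

mixedConstraints-cut : ∀ π x y r → mixedConstraints π (suc x ∷ suc y ∷ r)
  ≡ (keptConstraints π ++ replicate x ascent) ++ descent ∷ map exactly (cuts (suc y ∷ r))
mixedConstraints-cut π x y r = exactly-shape (keptConstraints π) x true (cuts (suc y ∷ r))

mixedConstraints-merged : ∀ π x y r → mixedConstraints π (suc x + suc y ∷ r)
  ≡ (keptConstraints π ++ replicate x ascent) ++ ascent ∷ map exactly (cuts (suc y ∷ r))
mixedConstraints-merged π x y r =
  trans (cong (λ bs → keptConstraints π ++ map exactly bs) (cuts-merge x y r))
        (exactly-shape (keptConstraints π) x false (cuts (suc y ∷ r)))

module _ {n : ℕ} (_≤ₚ_ : Rel (Fin n) 0ℓ) (_≤ₚ?_ : Decidable _≤ₚ_) (ℓ₀ : Vec (Fin n) n) where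

  linExtCount-free : ∀ cs es → linExtCount _≤ₚ_ _≤ₚ?_ ℓ₀ (cs ++ free ∷ es)
    ≡ linExtCount _≤ₚ_ _≤ₚ?_ ℓ₀ (cs ++ descent ∷ es) + linExtCount _≤ₚ_ _≤ₚ?_ ℓ₀ (cs ++ ascent ∷ es)
  linExtCount-free cs es = trans (count-split (fitting (cs ++ free ∷ es)) (λ ℓ → T? (fits (cs ++ descent ∷ es) (Des ℓ₀ ℓ))) Vs)
    (cong₂ _+_
      (count-cong _ (fitting (cs ++ descent ∷ es))
        ((λ ((isExt , _) , d) → isExt , d) ,
         (λ (isExt , d) → (isExt , fits-free⇐ cs es _ (inj₁ d)) , d)) Vs)
      (count-cong _ (fitting (cs ++ ascent ∷ es))
        ((λ ((isExt , f) , ¬d) → isExt , ascent-case f ¬d) ,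
         (λ (isExt , a) → (isExt , fits-free⇐ cs es _ (inj₂ a)) , (λ d → fits-descent-ascent-exclusive cs es _ d a))) Vs))
    where
    Vs = allVec n (allFin n)
    fitting = linExtFitting? _≤ₚ_ _≤ₚ?_ ℓ₀
    ascent-case : ∀ {ds} → T (fits (cs ++ free ∷ es) ds) → ¬ T (fits (cs ++ descent ∷ es) ds) → T (fits (cs ++ ascent ∷ es) ds)
    ascent-case {ds} h ¬d with fits-free⇒ cs es ds h
    ... | inj₁ d = ⊥-elim (¬d d)
    ... | inj₂ a = a

  linExtCount-exactly : ∀ (S : Subset (n ∸ 1)) bs → toList S ≡ bs →
                        linExtCount _≤ₚ_ _≤ₚ?_ ℓ₀ (map exactly bs) ≡ numLinExtWithDes _≤ₚ_ _≤ₚ?_ ℓ₀ S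
  linExtCount-exactly S bs S≡bs = count-cong _ _
    ((λ (isExt , fit) → isExt , trans (fits-exactly⇒ bs _ fit) (sym S≡bs)) ,
     (λ (isExt , des≡S) → isExt , subst (T ∘ fits (map exactly bs)) (sym (trans des≡S S≡bs)) (fits-exactly-refl bs)))
    (allVec n (allFin n))

  module _ (ℓ₀-ext : IsLinearExtension (reverseRel _≤ₚ_) ℓ₀) where

    private
      F : List ℕ → ℤ
      F γ = + flagF _≤ₚ_ _≤ₚ?_ γ

      N : List Constraint → ℕ
      N = linExtCount _≤ₚ_ _≤ₚ?_ ℓ₀

      +[m+n]-+n≡+m : ∀ m n → + (m + n) ℤ.- + n ≡ + m
      +[m+n]-+n≡+m m n = begin
        + (m + n) ℤ.- + n       ≡⟨ cong (ℤ._- + n) (ℤP.pos-+ m n) ⟩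
        (+ m ℤ.+ + n) ℤ.- + n   ≡⟨ ℤP.+-assoc (+ m) (+ n) (- + n) ⟩
        + m ℤ.+ (+ n ℤ.- + n)   ≡⟨ cong (ℤ._+_ (+ m)) (ℤP.+-inverseʳ (+ n)) ⟩
        + m ℤ.+ + 0             ≡⟨ ℤP.+-identityʳ (+ m) ⟩
        + m                     ∎
        where open ≡-Reasoning

    flagF≡linExtCount : ∀ γ → Positive γ → sum γ ≡ n → flagF _≤ₚ_ _≤ₚ?_ γ ≡ N (map atMost (cuts γ))
    flagF≡linExtCount γ = SetCompositionBijection.flagF≡linExtCount _≤ₚ_ _≤ₚ?_ ℓ₀ ℓ₀-ext γ

    alternatingSum≡linExtCount : ∀ r π x → Positive π → Positive (x ∷ r) → sum (π ++ x ∷ r) ≡ n →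
                                 alternatingSum F π (x ∷ r) ≡ + N (mixedConstraints π (x ∷ r))
    alternatingSum≡linExtCount r π zero _ (() ∷ _) _
    alternatingSum≡linExtCount (zero ∷ r) π x _ (_ ∷ () ∷ _) _
    alternatingSum≡linExtCount [] π (suc x) π>0 _ Σ≡n = begin
      (-1ℤ ℤ.^ 0) ℤ.* F (π ++ suc x ∷ []) ℤ.+ + 0   ≡⟨ ℤP.+-identityʳ _ ⟩
      (-1ℤ ℤ.^ 0) ℤ.* F (π ++ suc x ∷ [])           ≡⟨ ℤP.*-identityˡ _ ⟩
      F (π ++ suc x ∷ [])                           ≡⟨ cong +_ (flagF≡linExtCount (π ++ suc x ∷ []) (AllP.++⁺ π>0 (s≤s z≤n ∷ [])) Σ≡n) ⟩
      + N (map atMost (cuts (π ++ suc x ∷ [])))     ≡⟨ cong (+_ ∘ N) (atMost-cuts-snoc π x) ⟩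
      + N (keptConstraints π ++ replicate x ascent) ≡⟨ cong (λ cs → + N (keptConstraints π ++ cs)) (sym (ListP.map-replicate exactly x false)) ⟩
      + N (mixedConstraints π (suc x ∷ []))          ∎
      where open ≡-Reasoning
    alternatingSum≡linExtCount (suc y ∷ r) π (suc x) π>0 (_ ∷ _ ∷ r>0) Σ≡n = begin
      alternatingSum F π (suc x ∷ suc y ∷ r)
        ≡⟨ alternatingSum-cons₂ F π (suc x) (suc y) r ⟩
      alternatingSum F (π ++ suc x ∷ []) (suc y ∷ r) ℤ.- alternatingSum F π (suc x + suc y ∷ r)
        ≡⟨ cong₂ ℤ._-_ (alternatingSum≡linExtCount r (π ++ suc x ∷ []) (suc y) (AllP.++⁺ π>0 (s≤s z≤n ∷ [])) (s≤s z≤n ∷ r>0) Σ-kept)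
                       (alternatingSum≡linExtCount r π (suc x + suc y) π>0 (s≤s z≤n ∷ r>0) Σ-merged) ⟩
      + N (mixedConstraints (π ++ suc x ∷ []) (suc y ∷ r)) ℤ.- + N (mixedConstraints π (suc x + suc y ∷ r))
        ≡⟨ cong₂ (λ cs ds → + N cs ℤ.- + N ds) (mixedConstraints-kept π x y r) (mixedConstraints-merged π x y r) ⟩
      + N (K ++ free ∷ E) ℤ.- + N (K ++ ascent ∷ E)
        ≡⟨ cong (λ m → + m ℤ.- + N (K ++ ascent ∷ E)) (linExtCount-free K E) ⟩
      + (N (K ++ descent ∷ E) + N (K ++ ascent ∷ E)) ℤ.- + N (K ++ ascent ∷ E)
        ≡⟨ +[m+n]-+n≡+m (N (K ++ descent ∷ E)) (N (K ++ ascent ∷ E)) ⟩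
      + N (K ++ descent ∷ E)
        ≡⟨ cong (+_ ∘ N) (sym (mixedConstraints-cut π x y r)) ⟩
      + N (mixedConstraints π (suc x ∷ suc y ∷ r)) ∎
      where
      open ≡-Reasoning
      K = keptConstraints π ++ replicate x ascent
      E = map exactly (cuts (suc y ∷ r))
      Σ-kept : sum ((π ++ suc x ∷ []) ++ suc y ∷ r) ≡ n
      Σ-kept = trans (cong sum (ListP.++-assoc π (suc x ∷ []) (suc y ∷ r))) Σ≡n
      Σ-merged : sum (π ++ suc x + suc y ∷ r) ≡ n
      Σ-merged = trans (sum-++ π _) (trans (cong (_+_ (sum π)) (+-assoc (suc x) (suc y) (sum r))) (trans (sym (sum-++ π _)) Σ≡n))

    flagH≡linExtCount : ∀ α → Positive α → sum α ≡ n → flagH _≤ₚ_ _≤ₚ?_ α ≡ + N (map exactly (cuts α))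
    flagH≡linExtCount []      α>0 Σ≡n = trans (ℤP.+-identityʳ _) (trans (ℤP.*-identityˡ _) (cong +_ (flagF≡linExtCount [] α>0 Σ≡n)))
    flagH≡linExtCount (x ∷ r) α>0 Σ≡n = alternatingSum≡linExtCount r [] x [] α>0 Σ≡n

-- Coefficients of Ψ

partialSums-≥ : ∀ acc x r → All (acc + x ≤_) (partialSums acc (x ∷ r))
partialSums-≥ acc x []      = []
partialSums-≥ acc x (y ∷ r) = ≤-refl ∷ All.map (≤-trans (m≤m+n (acc + x) y)) (partialSums-≥ (acc + x) y r)

partialSums-shift : ∀ acc x r → partialSums acc (suc x ∷ r) ≡ partialSums (suc acc) (x ∷ r)
partialSums-shift acc x []      = refl
partialSums-shift acc x (y ∷ r) = cong (λ s → s ∷ partialSums s (y ∷ r)) (+-suc acc x)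

∈?-cons-≢ : ∀ {m a} L → m ≢ a → does (m ∈? a ∷ L) ≡ does (m ∈? L)
∈?-cons-≢ {m} {a} L m≢a = cong (_∨ does (m ∈? L)) (dec-false (m ≟ a) m≢a)

∈?partialSums≡cut : ∀ acc x r t → Positive r → suc t < suc x + sum r →
                     does ((acc + suc t) ∈? partialSums acc (suc x ∷ r)) ≡ bitAt (cuts (suc x ∷ r)) t
∈?partialSums≡cut acc zero    []          t       _ (s≤s ())
∈?partialSums≡cut acc zero    (zero ∷ r)  t       (() ∷ _) _
∈?partialSums≡cut acc zero    (suc y ∷ r) zero    _ _ = dec-true ((acc + 1) ∈? partialSums acc (1 ∷ suc y ∷ r)) (here refl)
∈?partialSums≡cut acc zero    (suc y ∷ r) (suc t) (_ ∷ r>0) (s≤s lt) = begin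
  does ((acc + suc (suc t)) ∈? (acc + 1) ∷ partialSums (acc + 1) (suc y ∷ r))
    ≡⟨ ∈?-cons-≢ (partialSums (acc + 1) (suc y ∷ r)) (λ eq → <-irrefl (sym eq) (+-monoʳ-< acc (s≤s (s≤s z≤n)))) ⟩
  does ((acc + suc (suc t)) ∈? partialSums (acc + 1) (suc y ∷ r))
    ≡⟨ cong (λ m → does (m ∈? partialSums (acc + 1) (suc y ∷ r))) (sym (+-assoc acc 1 (suc t))) ⟩
  does ((acc + 1 + suc t) ∈? partialSums (acc + 1) (suc y ∷ r))
    ≡⟨ ∈?partialSums≡cut (acc + 1) y r t r>0 lt ⟩
  bitAt (cuts (suc y ∷ r)) t ∎
  where open ≡-Reasoning
∈?partialSums≡cut acc (suc x) r   zero    _ _ =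
  trans (dec-false ((acc + 1) ∈? _) (λ mem → <⇒≱ (+-monoʳ-< acc (s≤s (s≤s z≤n))) (All.lookup (partialSums-≥ acc (suc (suc x)) r) mem)))
        (sym (cuts-head x r))
∈?partialSums≡cut acc (suc x) r   (suc t) r>0 (s≤s lt) = begin
  does ((acc + suc (suc t)) ∈? partialSums acc (suc (suc x) ∷ r))
    ≡⟨ cong₂ (λ m L → does (m ∈? L)) (+-suc acc (suc t)) (partialSums-shift acc (suc x) r) ⟩
  does ((suc acc + suc t) ∈? partialSums (suc acc) (suc x ∷ r))
    ≡⟨ ∈?partialSums≡cut (suc acc) x r t r>0 lt ⟩
  bitAt (cuts (suc x ∷ r)) t
    ≡⟨ sym (cuts-shift x r t) ⟩
  bitAt (cuts (suc (suc x) ∷ r)) (suc t) ∎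
  where open ≡-Reasoning

toList-tabulate≡ : ∀ {m} (g : Fin m → Bool) bs → length bs ≡ m → (∀ i → g i ≡ bitAt bs (toℕ i)) → toList (tabulate g) ≡ bs
toList-tabulate≡ {zero}  g []       _   _  = refl
toList-tabulate≡ {suc m} g (b ∷ bs) len eq =
  cong₂ _∷_ (eq Fin.zero) (toList-tabulate≡ (g ∘ Fin.suc) bs (suc-injective len) (eq ∘ Fin.suc))

toList-S≡cuts : ∀ n α → Positive α → sum α ≡ n → toList (S[_] {n} α) ≡ cuts α
toList-S≡cuts n []          _         refl = refl
toList-S≡cuts n (zero ∷ r)  (() ∷ _)  _
toList-S≡cuts n (suc x ∷ r) (x>0 ∷ r>0) Σ≡n = toList-tabulate≡ _ (cuts (suc x ∷ r)) (length-cuts (suc x ∷ r) (x>0 ∷ r>0) Σ≡n)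
  λ i → ∈?partialSums≡cut 0 x r (toℕ i) r>0 (subst (suc (toℕ i) <_) (sym Σ≡n) (<∸1⇒suc< (FinP.toℕ<n i)))

toList-injective : ∀ {m} {xs ys : Vec A m} → toList xs ≡ toList ys → xs ≡ ys
toList-injective {xs = xs} {ys} eq = trans (sym (VecP.cast-is-id refl xs)) (VecP.toList-injective refl xs ys eq)

-- fromCuts c bs: the composition with cuts bs, whose first part is already c positions long.
fromCuts : ℕ → List Bool → List ℕ
fromCuts c []           = suc c ∷ []
fromCuts c (false ∷ bs) = fromCuts (suc c) bs
fromCuts c (true ∷ bs)  = suc c ∷ fromCuts 0 bs

fromCuts-replicate : ∀ c m L → fromCuts c (replicate m false ++ L) ≡ fromCuts (c + m) L
fromCuts-replicate c zero    L = cong (λ d → fromCuts d L) (sym (+-identityʳ c))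
fromCuts-replicate c (suc m) L = trans (fromCuts-replicate (suc c) m L) (cong (λ d → fromCuts d L) (sym (+-suc c m)))

fromCuts-cuts : ∀ c x r → Positive r → fromCuts c (cuts (suc x ∷ r)) ≡ suc (c + x) ∷ r
fromCuts-cuts c x []          _         =
  trans (cong (fromCuts c) (sym (ListP.++-identityʳ (replicate x false)))) (fromCuts-replicate c x [])
fromCuts-cuts c x (zero ∷ r)  (() ∷ _)
fromCuts-cuts c x (suc y ∷ r) (_ ∷ r>0) =
  trans (fromCuts-replicate c x (true ∷ cuts (suc y ∷ r))) (cong (suc (c + x) ∷_) (fromCuts-cuts 0 y r r>0))

cuts-injective : ∀ α α′ → Positive α → Positive α′ → sum α ≡ sum α′ → cuts α ≡ cuts α′ → α ≡ α′
cuts-injective []          []            _          _           _  _  = refl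
cuts-injective []          (suc x′ ∷ r′) _          _           ()
cuts-injective (suc x ∷ r) []            _          _           ()
cuts-injective (zero ∷ r)  _             (() ∷ _)   _           _  _
cuts-injective _           (zero ∷ r′)   _          (() ∷ _)    _  _
cuts-injective (suc x ∷ r) (suc x′ ∷ r′) (_ ∷ r>0)  (_ ∷ r′>0) _  eq =
  trans (sym (fromCuts-cuts 0 x r r>0)) (trans (cong (fromCuts 0) eq) (fromCuts-cuts 0 x′ r′ r′>0))

fromCuts-properties : ∀ c bs → cuts (fromCuts c bs) ≡ replicate c false ++ bs
                             × Positive (fromCuts c bs) × sum (fromCuts c bs) ≡ suc (c + length bs)
fromCuts-properties c []           = sym (ListP.++-identityʳ _) , (s≤s z≤n ∷ []) , refl
fromCuts-properties c (false ∷ bs) =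
  let (cuts≡ , positive , Σ≡) = fromCuts-properties (suc c) bs in
  trans cuts≡ (replicate-snoc c) , positive , trans Σ≡ (cong suc (sym (+-suc c (length bs))))
  where
  replicate-snoc : ∀ c → replicate (suc c) false ++ bs ≡ replicate c false ++ false ∷ bs
  replicate-snoc zero    = refl
  replicate-snoc (suc c) = cong (false ∷_) (replicate-snoc c)
fromCuts-properties c (true ∷ bs) with fromCuts 0 bs | fromCuts-properties 0 bs
... | y ∷ r | cuts≡ , positive , Σ≡ =
  cong (λ cs → replicate c false ++ true ∷ cs) cuts≡ , s≤s z≤n ∷ positive , cong (_+_ (suc c)) Σ≡
... | []    | _ , _ , ()

compositionWithCuts : ∀ n (S : Subset (n ∸ 1)) → Σ (List ℕ) λ α → Positive α × sum α ≡ n × S[_] {n} α ≡ S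
compositionWithCuts zero    Vec.[] = [] , [] , refl , refl
compositionWithCuts (suc m) S      = α , positive , Σ≡ , toList-injective (trans (toList-S≡cuts (suc m) α positive Σ≡) cuts≡)
  where
  α = fromCuts 0 (toList S)
  props = fromCuts-properties 0 (toList S)
  cuts≡ = proj₁ props
  positive = proj₁ (proj₂ props)
  Σ≡ : sum α ≡ suc m
  Σ≡ = trans (proj₂ (proj₂ props)) (cong suc (VecP.length-toList S))

private
  parts : ℕ → List ℕ
  parts n = map suc (upTo n)

  ofLength : ℕ → ℕ → List (List ℕ)
  ofLength n k = map toList (allVec k (parts n))

∈-compositions⁺ : ∀ {n α} → Positive α → sum α ≡ n → α ∈ compositions n
∈-compositions⁺ {n} {α} α>0 Σ≡n = ∈-filter⁺ (λ α → sum α ≟ n) (∈-concatMap⁺ (ofLength n) (Any.map (λ { refl → α∈ }) len∈)) Σ≡n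
  where
  ≤sum : ∀ α → All (_≤ sum α) α
  ≤sum []      = []
  ≤sum (x ∷ α) = m≤m+n x (sum α) ∷ All.map (λ le → ≤-trans le (m≤n+m (sum α) x)) (≤sum α)
  length≤sum : ∀ {α} → Positive α → length α ≤ sum α
  length≤sum {[]}        []       = z≤n
  length≤sum {suc x ∷ α} (_ ∷ α>0) = s≤s (≤-trans (length≤sum α>0) (m≤n+m (sum α) x))
  part∈ : ∀ {e} → 0 < e → e ≤ n → e ∈ parts n
  part∈ {suc e} _ (s≤s e<n) = ∈-map⁺ suc (∈-upTo⁺ (s≤s e<n))
  entries : All (_∈ parts n) (toList (Vec.fromList α))
  entries = subst (All (_∈ parts n)) (sym (VecP.toList∘fromList α)) (All.zipWith (λ (pos , le) → part∈ pos (subst (_ ≤_) Σ≡n le)) (α>0 , ≤sum α))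
  α∈ : α ∈ ofLength n (length α)
  α∈ = subst (_∈ ofLength n (length α)) (VecP.toList∘fromList α) (∈-map⁺ toList (∈-allVec⁺ (Vec.fromList α) entries))
  len∈ : length α ∈ upTo (suc n)
  len∈ = ∈-upTo⁺ (s≤s (subst (length α ≤_) Σ≡n (length≤sum α>0)))

∈-compositions⁻ : ∀ {n α} → α ∈ compositions n → Positive α × sum α ≡ n
∈-compositions⁻ {n} {α} α∈ with ∈-filter⁻ (λ α → sum α ≟ n) {xs = concatMap (ofLength n) (upTo (suc n))} α∈
... | α∈′ , Σ≡n with find (∈-concatMap⁻ (ofLength n) {xs = upTo (suc n)} α∈′)
... | k , _ , α∈k with ∈-map⁻ toList α∈k
... | v , v∈ , refl = All.map positive (∈-allVec⁻ v v∈) , Σ≡n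
  where
  positive : ∀ {e} → e ∈ parts n → 0 < e
  positive e∈ with ∈-map⁻ suc e∈
  ... | _ , _ , refl = s≤s z≤n

Unique-compositions : ∀ n → Unique (compositions n)
Unique-compositions n = UniqueP.filter⁺ (λ α → sum α ≟ n) (concat-unique (UniqueP.upTo⁺ (suc n)))
  where
  length-ofLength : ∀ {k α} → α ∈ ofLength n k → length α ≡ k
  length-ofLength {k} α∈ with ∈-map⁻ toList α∈
  ... | v , _ , refl = VecP.length-toList v
  concat-unique : ∀ {ks} → Unique ks → Unique (concatMap (ofLength n) ks)
  concat-unique [] = []
  concat-unique {k ∷ ks} (k∉ks ∷ ks!) =
    UniqueP.++⁺ (UniqueP.map⁺ toList-injective (Unique-allVec (UniqueP.map⁺ suc-injective (UniqueP.upTo⁺ n))))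
                (concat-unique ks!) disjoint
    where
    disjoint : ∀ {α} → α ∈ ofLength n k × α ∈ concatMap (ofLength n) ks → ⊥
    disjoint (α∈k , α∈ks) with find (∈-concatMap⁻ (ofLength n) {xs = ks} α∈ks)
    ... | k′ , k′∈ks , α∈k′ = All.lookup k∉ks k′∈ks (trans (sym (length-ofLength α∈k)) (length-ofLength α∈k′))

S[]-injective : ∀ n {α α′} → Positive α → Positive α′ → sum α ≡ n → sum α′ ≡ n → S[_] {n} α ≡ S[_] {n} α′ → α ≡ α′
S[]-injective n {α} {α′} α>0 α′>0 Σ≡n Σ′≡n eq = cuts-injective α α′ α>0 α′>0 (trans Σ≡n (sym Σ′≡n))
  (trans (sym (toList-S≡cuts n α α>0 Σ≡n)) (trans (cong toList eq) (toList-S≡cuts n α′ α′>0 Σ′≡n)))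

Vec-map-injective : (f : A → B) → (∀ {x y} → f x ≡ f y → x ≡ y) →
                    ∀ {k} {xs ys : Vec A k} → Vec.map f xs ≡ Vec.map f ys → xs ≡ ys
Vec-map-injective f f-inj {xs = Vec.[]}    {Vec.[]}    _  = refl
Vec-map-injective f f-inj {xs = x Vec.∷ xs} {y Vec.∷ ys} eq =
  cong₂ Vec._∷_ (f-inj (VecP.∷-injectiveˡ eq)) (Vec-map-injective f f-inj (VecP.∷-injectiveʳ eq))

m[]-injective : ∀ {k} {S T : Subset k} → m[ S ] ≡ m[ T ] → S ≡ T
m[]-injective = Vec-map-injective (λ s → if s then 𝐛 else 𝐚) letter-injective
  where
  letter-injective : ∀ {s t} → (if s then 𝐛 else 𝐚) ≡ (if t then 𝐛 else 𝐚) → s ≡ t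
  letter-injective {true}  {true}  _ = refl
  letter-injective {false} {false} _ = refl
  letter-injective {true}  {false} ()
  letter-injective {false} {true}  ()

coeff-map : ∀ {k} (w : Vec AB k) (f : A → Vec AB k) (h : A → ℤ) xs →
            coeff w (map (λ x → f x , h x) xs) ≡ sumℤ (map h (filter (λ x → VecP.≡-dec _≟AB_ (f x) w) xs))
coeff-map w f h []       = refl
coeff-map w f h (x ∷ xs) with VecP.≡-dec _≟AB_ (f x) w
... | yes _ = cong (ℤ._+_ (h x)) (coeff-map w f h xs)
... | no _  = coeff-map w f h xs

Unique-∈-All≡⇒singleton : ∀ {a} {L : List A} → Unique L → a ∈ L → All (_≡ a) L → L ≡ a ∷ []
Unique-∈-All≡⇒singleton _ (here refl) (_ ∷ []) = refl
Unique-∈-All≡⇒singleton (x∉ ∷ _) _ (x≡a ∷ y≡a ∷ _) = ⊥-elim (All.lookup x∉ (here refl) (trans x≡a (sym y≡a)))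
Unique-∈-All≡⇒singleton (_ ∷ _) (there ()) (_ ∷ [])

module CompositionWith (n : ℕ) (S : Subset (n ∸ 1)) where

  α₀ : List ℕ
  α₀ = proj₁ (compositionWithCuts n S)

  α₀>0 : Positive α₀
  α₀>0 = proj₁ (proj₂ (compositionWithCuts n S))

  Σα₀≡n : sum α₀ ≡ n
  Σα₀≡n = proj₁ (proj₂ (proj₂ (compositionWithCuts n S)))

  S[α₀]≡S : S[_] {n} α₀ ≡ S
  S[α₀]≡S = proj₂ (proj₂ (proj₂ (compositionWithCuts n S)))

  cuts-α₀ : toList S ≡ cuts α₀
  cuts-α₀ = trans (cong toList (sym S[α₀]≡S)) (toList-S≡cuts n α₀ α₀>0 Σα₀≡n)

  compositionsWithS : filter (λ α → VecP.≡-dec _≟AB_ m[ S[_] {n} α ] m[ S ]) (compositions n)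
                      ≡ α₀ ∷ []
  compositionsWithS = Unique-∈-All≡⇒singleton
    (UniqueP.filter⁺ _ (Unique-compositions n))
    (∈-filter⁺ _ (∈-compositions⁺ α₀>0 Σα₀≡n) (cong m[_] S[α₀]≡S))
    (All.tabulate λ α∈ → let (α∈comps , same) = ∈-filter⁻ _ {xs = compositions n} α∈
                             (α>0 , Σα≡n) = ∈-compositions⁻ α∈comps in
      S[]-injective n α>0 α₀>0 Σα≡n Σα₀≡n (trans (m[]-injective same) (sym S[α₀]≡S)))

mainTheorem16 : (n : ℕ) (_≤ₚ_ : Rel (Fin n) 0ℓ)
    → (po : IsDecPartialOrder _≡_ _≤ₚ_)
    → (ℓ₀ : Vec (Fin n) n) → IsLinearExtension (reverseRel _≤ₚ_) ℓ₀
    → (S : Subset (n ∸ 1))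
    → coeff m[ S ] (Ψζ _≤ₚ_ (IsDecPartialOrder._≤?_ po))
      ≡ + numLinExtWithDes _≤ₚ_ (IsDecPartialOrder._≤?_ po) ℓ₀ S
mainTheorem16 n _≤ₚ_ po ℓ₀ ℓ₀-ext S = begin
  coeff m[ S ] (Ψζ _≤ₚ_ _≤ₚ?_)
    ≡⟨ coeff-map m[ S ] (λ α → m[ S[_] {n} α ]) (flagH _≤ₚ_ _≤ₚ?_) (compositions n) ⟩
  sumℤ (map (flagH _≤ₚ_ _≤ₚ?_) (filter (λ α → VecP.≡-dec _≟AB_ m[ S[_] {n} α ] m[ S ]) (compositions n)))
    ≡⟨ cong (sumℤ ∘ map (flagH _≤ₚ_ _≤ₚ?_)) compositionsWithS ⟩
  flagH _≤ₚ_ _≤ₚ?_ α₀ ℤ.+ + 0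
    ≡⟨ ℤP.+-identityʳ _ ⟩
  flagH _≤ₚ_ _≤ₚ?_ α₀
    ≡⟨ flagH≡linExtCount _≤ₚ_ _≤ₚ?_ ℓ₀ ℓ₀-ext α₀ α₀>0 Σα₀≡n ⟩
  + linExtCount _≤ₚ_ _≤ₚ?_ ℓ₀ (map exactly (cuts α₀))
    ≡⟨ cong +_ (linExtCount-exactly _≤ₚ_ _≤ₚ?_ ℓ₀ S (cuts α₀) cuts-α₀) ⟩
  + numLinExtWithDes _≤ₚ_ _≤ₚ?_ ℓ₀ S ∎
  where
  open ≡-Reasoning
  open CompositionWith n S
  _≤ₚ?_ = IsDecPartialOrder._≤?_ po
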